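{- Let $G\in\{\mathbf{K},\mathbf{KD},\mathbf{KT},\mathbf{K4},\mathbf{KD4},\mathbf{S4}\}$. Maehara interpolation in $G$ with cuts only on atomic formulas and boxed formulas is complete: for every $G$-provable implication $A\to B$ and every formula $C$ with $V(C)\subseteq V(A)\cap V(B)$ such that $A\to C$ and $C\to B$ are $G$-provable, there is a proof $\pi$ of the split sequent $A;\Rightarrow;B$ in $G$, using only cuts whose cut formula is an atom, $\bot$, $\top$, or of the form $\Box D$, such that $\mathcal{M}(\pi)\leftrightarrow C$ is provable in $G$.
   Context: Modal formulas are built from atoms and $\bot$ using $\wedge,\vee,\neg,\Box$; $A\to B$ abbreviates $\neg A\vee B$, $A\leftrightarrow B$ abbreviates $(A\to B)\wedge(B\to A)$, $\top$ abbreviates $\bot\to\bot$; $V(A)$ is the set of atoms of $A$, extended to multisets. For a multiset $\Gamma$, $\Box\Gamma=\{\Box A\mid A\in\Gamma\}$. $\mathbf{LK}$ here has axioms $p\Rightarrow p$ ($p$ an atom), $\Box A\Rightarrow\Box A$, and $\bot\Rightarrow$, and rules weakening, contraction, $(L\wedge_1),(L\wedge_2),(R\wedge),(R\vee_1),(R\vee_2),(L\vee),(L\neg),(R\neg)$ and cut ($\Gamma\Rightarrow\Delta,A$ and $A,\Gamma\Rightarrow\Delta$ / $\Gamma\Rightarrow\Delta$) in standard Gentzen G1 form. Modal rules: $(K)$: $\Gamma\Rightarrow A$ / $\Box\Gamma\Rightarrow\Box A$; $(D)$: $\Gamma\Rightarrow$ / $\Box\Gamma\Rightarrow$; $(4)$: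 $\Gamma,\Box\Gamma\Rightarrow A$ / $\Box\Gamma\Rightarrow\Box A$; $(T)$: $\Gamma,A\Rightarrow\Delta$ / $\Gamma,\Box A\Rightarrow\Delta$. $\mathbf{K}=\mathbf{LK}+(K)$, $\mathbf{KD}=\mathbf{LK}+(K)+(D)$, $\mathbf{KT}=\mathbf{LK}+(K)+(T)$, $\mathbf{K4}=\mathbf{LK}+(4)$, $\mathbf{KD4}=\mathbf{LK}+(4)+(D)$, $\mathbf{S4}=\mathbf{LK}+(T)+(4)$. A split sequent $\Gamma_1;\Gamma_2\Rightarrow\Delta_1;\Delta_2$ is the sequent $\Gamma_1,\Gamma_2\Rightarrow\Delta_1,\Delta_2$ with formulas divided into a left side ($\Gamma_1,\Delta_1$) and a right side ($\Gamma_2,\Delta_2$). In a proof of a split sequent every sequent is split, context formulas keep their side, auxiliary formulas lie on the side of the main formula (in modal rules each $\Box D$ or $D$ in the conclusion lies on the side of the corresponding premise formula(s)), and for a cut with conclusion $\Gamma_1;\Gamma_2\Rightarrow\Delta_1;\Delta_2$ and cut formula $A$ both occurrences of $A$ lie on the left side (allowed only if $V(A)\subseteq V(\Gamma_1\cup\Delta_1)$) or both on the right side (allowed only if $V(A)\subseteq V(\Gamma_2\cup\Delta_2)$). The Maehara interpolant $\mathcal{M}(\pi)$: for an axiom with formula $X$ (an atom or a boxed formula), $X;\Rightarrow X;$ gives $\bot$, $;X\Rightarrow;X$ gives $\top$, $X;\Rightarrow;X$ gives $X$, $;X\Rightarrow X;$ gives $\neg X$; $\bot;\Rightarrow;$ gives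 $\bot$, $;\bot\Rightarrow;$ gives $\top$; propositional unary rules and $(T)$ keep the premise's interpolant; a binary rule ($(R\wedge)$, $(L\vee)$, cut) with premise proofs $\pi_1,\pi_2$ gives $\mathcal{M}(\pi_1)\vee\mathcal{M}(\pi_2)$ if its main/cut formula is on the left side and $\mathcal{M}(\pi_1)\wedge\mathcal{M}(\pi_2)$ if on the right side; if the premise interpolant is $C$: $(K)$ from $\Gamma_1;\Gamma_2\Rightarrow;A$ to $\Box\Gamma_1;\Box\Gamma_2\Rightarrow;\Box A$ gives $\Box C$, and from $\Gamma_1;\Gamma_2\Rightarrow A;$ to $\Box\Gamma_1;\Box\Gamma_2\Rightarrow\Box A;$ gives $\neg\Box\neg C$; $(4)$ from $\Gamma_1,\Box\Gamma_1;\Gamma_2,\Box\Gamma_2\Rightarrow;A$ (resp. $\Rightarrow A;$) to $\Box\Gamma_1;\Box\Gamma_2\Rightarrow;\Box A$ (resp. $\Rightarrow\Box A;$) gives $\Box C$ (resp. $\neg\Box\neg C$); $(D)$ from $\Gamma_1;\Gamma_2\Rightarrow$ to $\Box\Gamma_1;\Box\Gamma_2\Rightarrow$ gives $\Box C$. -}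

module Defs where

open import Data.Nat using (ℕ)
open import Data.List using (List; []; _∷_; _++_; map; concatMap)
open import Data.List.Relation.Binary.Subset.Propositional using (_⊆_)
open import Data.List.Relation.Binary.Permutation.Propositional using (_↭_)

infixr 9 _∧'_
infixr 8 _∨'_
infixr 7 _⊃_
infix  6 _⇔_

data Fm : Set where
  at  : ℕ → Fm
  ⊥'  : Fm
  _∧'_ : Fm → Fm → Fm
  _∨'_ : Fm → Fm → Fm
  ¬'  : Fm → Fm
  □   : Fm → Fm

_⊃_ : Fm → Fm → Fm
A ⊃ B = ¬' A ∨' B

_⇔_ : Fm → Fm → Fm
A ⇔ B = (A ⊃ B) ∧' (B ⊃ A)

⊤' : Fm
⊤' = ⊥' ⊃ ⊥'

V : Fm → List ℕ
V (at p)   = p ∷ []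
V ⊥'       = []
V (A ∧' B) = V A ++ V B
V (A ∨' B) = V A ++ V B
V (¬' A)   = V A
V (□ A)    = V A

Vs : List Fm → List ℕ
Vs = concatMap V

□s : List Fm → List Fm
□s = map □

data Logic : Set where
  K KD KT K4 KD4 S4 : Logic

data HasK : Logic → Set where
  K-K : HasK K
  KD-K : HasK KD
  KT-K : HasK KT

data HasD : Logic → Set where
  KD-D : HasD KD
  KD4-D : HasD KD4

data HasT : Logic → Set where
  KT-T : HasT KT
  S4-T : HasT S4

data Has4 : Logic → Set where
  K4-4 : Has4 K4
  KD4-4 : Has4 KD4
  S4-4 : Has4 S4

-- Ordinary (unsplit) G1-style derivations of Γ ⇒ Δ in logic G.
-- Sequents are multisets, represented as lists with an exchange
-- (permutation) rule; principal formulas are written at the head.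

data Prf (G : Logic) : List Fm → List Fm → Set where
  ax-at  : ∀ p → Prf G (at p ∷ []) (at p ∷ [])
  ax-□   : ∀ A → Prf G (□ A ∷ []) (□ A ∷ [])
  ax-⊥   : Prf G (⊥' ∷ []) []
  exch   : ∀ {Γ Γ' Δ Δ'} → Γ ↭ Γ' → Δ ↭ Δ' → Prf G Γ Δ → Prf G Γ' Δ'
  wL     : ∀ {Γ Δ} A → Prf G Γ Δ → Prf G (A ∷ Γ) Δ
  wR     : ∀ {Γ Δ} A → Prf G Γ Δ → Prf G Γ (A ∷ Δ)
  cL     : ∀ {Γ Δ A} → Prf G (A ∷ A ∷ Γ) Δ → Prf G (A ∷ Γ) Δ
  cR     : ∀ {Γ Δ A} → Prf G Γ (A ∷ A ∷ Δ) → Prf G Γ (A ∷ Δ)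
  L∧₁    : ∀ {Γ Δ A} B → Prf G (A ∷ Γ) Δ → Prf G (A ∧' B ∷ Γ) Δ
  L∧₂    : ∀ {Γ Δ B} A → Prf G (B ∷ Γ) Δ → Prf G (A ∧' B ∷ Γ) Δ
  R∧     : ∀ {Γ Δ A B} → Prf G Γ (A ∷ Δ) → Prf G Γ (B ∷ Δ) → Prf G Γ (A ∧' B ∷ Δ)
  R∨₁    : ∀ {Γ Δ A} B → Prf G Γ (A ∷ Δ) → Prf G Γ (A ∨' B ∷ Δ)
  R∨₂    : ∀ {Γ Δ B} A → Prf G Γ (B ∷ Δ) → Prf G Γ (A ∨' B ∷ Δ)
  L∨     : ∀ {Γ Δ A B} → Prf G (A ∷ Γ) Δ → Prf G (B ∷ Γ) Δ → Prf G (A ∨' B ∷ Γ) Δ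
  L¬     : ∀ {Γ Δ A} → Prf G Γ (A ∷ Δ) → Prf G (¬' A ∷ Γ) Δ
  R¬     : ∀ {Γ Δ A} → Prf G (A ∷ Γ) Δ → Prf G Γ (¬' A ∷ Δ)
  cut    : ∀ {Γ Δ} A → Prf G Γ (A ∷ Δ) → Prf G (A ∷ Γ) Δ → Prf G Γ Δ
  ruleK  : ∀ {Γ A} → HasK G → Prf G Γ (A ∷ []) → Prf G (□s Γ) (□ A ∷ [])
  ruleD  : ∀ {Γ} → HasD G → Prf G Γ [] → Prf G (□s Γ) []
  rule4  : ∀ {Γ A} → Has4 G → Prf G (Γ ++ □s Γ) (A ∷ []) → Prf G (□s Γ) (□ A ∷ [])
  ruleT  : ∀ {Γ Δ A} → HasT G → Prf G (A ∷ Γ) Δ → Prf G (□ A ∷ Γ) Δ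

_⊢_ : Logic → Fm → Set
G ⊢ A = Prf G [] (A ∷ [])

-- Split derivations of Γ₁ ; Γ₂ ⇒ Δ₁ ; Δ₂ in logic G.
-- Suffix "ˡ" : main (and auxiliary) formula on the left side,
-- suffix "ʳ" : on the right side.  The parameter Ok restricts which
-- formulas may be used as cut formulas (Ok = λ _ → ⊤ gives all cuts).

module _ (G : Logic) (Ok : Fm → Set) where

  data SPrf : List Fm → List Fm → List Fm → List Fm → Set where
    ax-at-ll : ∀ p → SPrf (at p ∷ []) [] (at p ∷ []) []
    ax-at-rr : ∀ p → SPrf [] (at p ∷ []) [] (at p ∷ [])
    ax-at-lr : ∀ p → SPrf (at p ∷ []) [] [] (at p ∷ [])
    ax-at-rl : ∀ p → SPrf [] (at p ∷ []) (at p ∷ []) []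
    ax-□-ll  : ∀ A → SPrf (□ A ∷ []) [] (□ A ∷ []) []
    ax-□-rr  : ∀ A → SPrf [] (□ A ∷ []) [] (□ A ∷ [])
    ax-□-lr  : ∀ A → SPrf (□ A ∷ []) [] [] (□ A ∷ [])
    ax-□-rl  : ∀ A → SPrf [] (□ A ∷ []) (□ A ∷ []) []
    ax-⊥ˡ    : SPrf (⊥' ∷ []) [] [] []
    ax-⊥ʳ    : SPrf [] (⊥' ∷ []) [] []
    exch : ∀ {Γ₁ Γ₂ Δ₁ Δ₂ Γ₁' Γ₂' Δ₁' Δ₂'} →
           Γ₁ ↭ Γ₁' → Γ₂ ↭ Γ₂' → Δ₁ ↭ Δ₁' → Δ₂ ↭ Δ₂' →
           SPrf Γ₁ Γ₂ Δ₁ Δ₂ → SPrf Γ₁' Γ₂' Δ₁' Δ₂'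
    wLˡ : ∀ {Γ₁ Γ₂ Δ₁ Δ₂} A → SPrf Γ₁ Γ₂ Δ₁ Δ₂ → SPrf (A ∷ Γ₁) Γ₂ Δ₁ Δ₂
    wLʳ : ∀ {Γ₁ Γ₂ Δ₁ Δ₂} A → SPrf Γ₁ Γ₂ Δ₁ Δ₂ → SPrf Γ₁ (A ∷ Γ₂) Δ₁ Δ₂
    wRˡ : ∀ {Γ₁ Γ₂ Δ₁ Δ₂} A → SPrf Γ₁ Γ₂ Δ₁ Δ₂ → SPrf Γ₁ Γ₂ (A ∷ Δ₁) Δ₂
    wRʳ : ∀ {Γ₁ Γ₂ Δ₁ Δ₂} A → SPrf Γ₁ Γ₂ Δ₁ Δ₂ → SPrf Γ₁ Γ₂ Δ₁ (A ∷ Δ₂)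
    cLˡ : ∀ {Γ₁ Γ₂ Δ₁ Δ₂ A} → SPrf (A ∷ A ∷ Γ₁) Γ₂ Δ₁ Δ₂ → SPrf (A ∷ Γ₁) Γ₂ Δ₁ Δ₂
    cLʳ : ∀ {Γ₁ Γ₂ Δ₁ Δ₂ A} → SPrf Γ₁ (A ∷ A ∷ Γ₂) Δ₁ Δ₂ → SPrf Γ₁ (A ∷ Γ₂) Δ₁ Δ₂
    cRˡ : ∀ {Γ₁ Γ₂ Δ₁ Δ₂ A} → SPrf Γ₁ Γ₂ (A ∷ A ∷ Δ₁) Δ₂ → SPrf Γ₁ Γ₂ (A ∷ Δ₁) Δ₂
    cRʳ : ∀ {Γ₁ Γ₂ Δ₁ Δ₂ A} → SPrf Γ₁ Γ₂ Δ₁ (A ∷ A ∷ Δ₂) → SPrf Γ₁ Γ₂ Δ₁ (A ∷ Δ₂)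
    L∧₁ˡ : ∀ {Γ₁ Γ₂ Δ₁ Δ₂ A} B → SPrf (A ∷ Γ₁) Γ₂ Δ₁ Δ₂ → SPrf (A ∧' B ∷ Γ₁) Γ₂ Δ₁ Δ₂
    L∧₁ʳ : ∀ {Γ₁ Γ₂ Δ₁ Δ₂ A} B → SPrf Γ₁ (A ∷ Γ₂) Δ₁ Δ₂ → SPrf Γ₁ (A ∧' B ∷ Γ₂) Δ₁ Δ₂
    L∧₂ˡ : ∀ {Γ₁ Γ₂ Δ₁ Δ₂ B} A → SPrf (B ∷ Γ₁) Γ₂ Δ₁ Δ₂ → SPrf (A ∧' B ∷ Γ₁) Γ₂ Δ₁ Δ₂
    L∧₂ʳ : ∀ {Γ₁ Γ₂ Δ₁ Δ₂ B} A → SPrf Γ₁ (B ∷ Γ₂) Δ₁ Δ₂ → SPrf Γ₁ (A ∧' B ∷ Γ₂) Δ₁ Δ₂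
    R∧ˡ : ∀ {Γ₁ Γ₂ Δ₁ Δ₂ A B} → SPrf Γ₁ Γ₂ (A ∷ Δ₁) Δ₂ → SPrf Γ₁ Γ₂ (B ∷ Δ₁) Δ₂ →
          SPrf Γ₁ Γ₂ (A ∧' B ∷ Δ₁) Δ₂
    R∧ʳ : ∀ {Γ₁ Γ₂ Δ₁ Δ₂ A B} → SPrf Γ₁ Γ₂ Δ₁ (A ∷ Δ₂) → SPrf Γ₁ Γ₂ Δ₁ (B ∷ Δ₂) →
          SPrf Γ₁ Γ₂ Δ₁ (A ∧' B ∷ Δ₂)
    R∨₁ˡ : ∀ {Γ₁ Γ₂ Δ₁ Δ₂ A} B → SPrf Γ₁ Γ₂ (A ∷ Δ₁) Δ₂ → SPrf Γ₁ Γ₂ (A ∨' B ∷ Δ₁) Δ₂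
    R∨₁ʳ : ∀ {Γ₁ Γ₂ Δ₁ Δ₂ A} B → SPrf Γ₁ Γ₂ Δ₁ (A ∷ Δ₂) → SPrf Γ₁ Γ₂ Δ₁ (A ∨' B ∷ Δ₂)
    R∨₂ˡ : ∀ {Γ₁ Γ₂ Δ₁ Δ₂ B} A → SPrf Γ₁ Γ₂ (B ∷ Δ₁) Δ₂ → SPrf Γ₁ Γ₂ (A ∨' B ∷ Δ₁) Δ₂
    R∨₂ʳ : ∀ {Γ₁ Γ₂ Δ₁ Δ₂ B} A → SPrf Γ₁ Γ₂ Δ₁ (B ∷ Δ₂) → SPrf Γ₁ Γ₂ Δ₁ (A ∨' B ∷ Δ₂)
    L∨ˡ : ∀ {Γ₁ Γ₂ Δ₁ Δ₂ A B} → SPrf (A ∷ Γ₁) Γ₂ Δ₁ Δ₂ → SPrf (B ∷ Γ₁) Γ₂ Δ₁ Δ₂ →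
          SPrf (A ∨' B ∷ Γ₁) Γ₂ Δ₁ Δ₂
    L∨ʳ : ∀ {Γ₁ Γ₂ Δ₁ Δ₂ A B} → SPrf Γ₁ (A ∷ Γ₂) Δ₁ Δ₂ → SPrf Γ₁ (B ∷ Γ₂) Δ₁ Δ₂ →
          SPrf Γ₁ (A ∨' B ∷ Γ₂) Δ₁ Δ₂
    L¬ˡ : ∀ {Γ₁ Γ₂ Δ₁ Δ₂ A} → SPrf Γ₁ Γ₂ (A ∷ Δ₁) Δ₂ → SPrf (¬' A ∷ Γ₁) Γ₂ Δ₁ Δ₂
    L¬ʳ : ∀ {Γ₁ Γ₂ Δ₁ Δ₂ A} → SPrf Γ₁ Γ₂ Δ₁ (A ∷ Δ₂) → SPrf Γ₁ (¬' A ∷ Γ₂) Δ₁ Δ₂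
    R¬ˡ : ∀ {Γ₁ Γ₂ Δ₁ Δ₂ A} → SPrf (A ∷ Γ₁) Γ₂ Δ₁ Δ₂ → SPrf Γ₁ Γ₂ (¬' A ∷ Δ₁) Δ₂
    R¬ʳ : ∀ {Γ₁ Γ₂ Δ₁ Δ₂ A} → SPrf Γ₁ (A ∷ Γ₂) Δ₁ Δ₂ → SPrf Γ₁ Γ₂ Δ₁ (¬' A ∷ Δ₂)
    cutˡ : ∀ {Γ₁ Γ₂ Δ₁ Δ₂} A → Ok A → V A ⊆ Vs (Γ₁ ++ Δ₁) →
           SPrf Γ₁ Γ₂ (A ∷ Δ₁) Δ₂ → SPrf (A ∷ Γ₁) Γ₂ Δ₁ Δ₂ → SPrf Γ₁ Γ₂ Δ₁ Δ₂
    cutʳ : ∀ {Γ₁ Γ₂ Δ₁ Δ₂} A → Ok A → V A ⊆ Vs (Γ₂ ++ Δ₂) →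
           SPrf Γ₁ Γ₂ Δ₁ (A ∷ Δ₂) → SPrf Γ₁ (A ∷ Γ₂) Δ₁ Δ₂ → SPrf Γ₁ Γ₂ Δ₁ Δ₂
    ruleKˡ : ∀ {Γ₁ Γ₂ A} → HasK G → SPrf Γ₁ Γ₂ (A ∷ []) [] →
             SPrf (□s Γ₁) (□s Γ₂) (□ A ∷ []) []
    ruleKʳ : ∀ {Γ₁ Γ₂ A} → HasK G → SPrf Γ₁ Γ₂ [] (A ∷ []) →
             SPrf (□s Γ₁) (□s Γ₂) [] (□ A ∷ [])
    ruleD  : ∀ {Γ₁ Γ₂} → HasD G → SPrf Γ₁ Γ₂ [] [] → SPrf (□s Γ₁) (□s Γ₂) [] []
    rule4ˡ : ∀ {Γ₁ Γ₂ A} → Has4 G → SPrf (Γ₁ ++ □s Γ₁) (Γ₂ ++ □s Γ₂) (A ∷ []) [] →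
             SPrf (□s Γ₁) (□s Γ₂) (□ A ∷ []) []
    rule4ʳ : ∀ {Γ₁ Γ₂ A} → Has4 G → SPrf (Γ₁ ++ □s Γ₁) (Γ₂ ++ □s Γ₂) [] (A ∷ []) →
             SPrf (□s Γ₁) (□s Γ₂) [] (□ A ∷ [])
    ruleTˡ : ∀ {Γ₁ Γ₂ Δ₁ Δ₂ A} → HasT G → SPrf (A ∷ Γ₁) Γ₂ Δ₁ Δ₂ → SPrf (□ A ∷ Γ₁) Γ₂ Δ₁ Δ₂
    ruleTʳ : ∀ {Γ₁ Γ₂ Δ₁ Δ₂ A} → HasT G → SPrf Γ₁ (A ∷ Γ₂) Δ₁ Δ₂ → SPrf Γ₁ (□ A ∷ Γ₂) Δ₁ Δ₂

  M : ∀ {Γ₁ Γ₂ Δ₁ Δ₂} → SPrf Γ₁ Γ₂ Δ₁ Δ₂ → Fm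
  M (ax-at-ll p) = ⊥'
  M (ax-at-rr p) = ⊤'
  M (ax-at-lr p) = at p
  M (ax-at-rl p) = ¬' (at p)
  M (ax-□-ll A)  = ⊥'
  M (ax-□-rr A)  = ⊤'
  M (ax-□-lr A)  = □ A
  M (ax-□-rl A)  = ¬' (□ A)
  M ax-⊥ˡ        = ⊥'
  M ax-⊥ʳ        = ⊤'
  M (exch _ _ _ _ π) = M π
  M (wLˡ _ π) = M π
  M (wLʳ _ π) = M π
  M (wRˡ _ π) = M π
  M (wRʳ _ π) = M π
  M (cLˡ π) = M π
  M (cLʳ π) = M π
  M (cRˡ π) = M π
  M (cRʳ π) = M π
  M (L∧₁ˡ _ π) = M π
  M (L∧₁ʳ _ π) = M π
  M (L∧₂ˡ _ π) = M π
  M (L∧₂ʳ _ π) = M π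
  M (R∧ˡ π₁ π₂) = M π₁ ∨' M π₂
  M (R∧ʳ π₁ π₂) = M π₁ ∧' M π₂
  M (R∨₁ˡ _ π) = M π
  M (R∨₁ʳ _ π) = M π
  M (R∨₂ˡ _ π) = M π
  M (R∨₂ʳ _ π) = M π
  M (L∨ˡ π₁ π₂) = M π₁ ∨' M π₂
  M (L∨ʳ π₁ π₂) = M π₁ ∧' M π₂
  M (L¬ˡ π) = M π
  M (L¬ʳ π) = M π
  M (R¬ˡ π) = M π
  M (R¬ʳ π) = M π
  M (cutˡ _ _ _ π₁ π₂) = M π₁ ∨' M π₂
  M (cutʳ _ _ _ π₁ π₂) = M π₁ ∧' M π₂
  M (ruleKˡ _ π) = ¬' (□ (¬' (M π)))
  M (ruleKʳ _ π) = □ (M π)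
  M (ruleD _ π)  = □ (M π)
  M (rule4ˡ _ π) = ¬' (□ (¬' (M π)))
  M (rule4ʳ _ π) = □ (M π)
  M (ruleTˡ _ π) = M π
  M (ruleTʳ _ π) = M π

data AtomicOrBoxed : Fm → Set where
  cf-at : ∀ p → AtomicOrBoxed (at p)
  cf-⊥  : AtomicOrBoxed ⊥'
  cf-⊤  : AtomicOrBoxed ⊤'
  cf-□  : ∀ D → AtomicOrBoxed (□ D)

-- Write C in conjunctive normal form over literals that are atoms, ⊥ or boxed formulas.  Given
-- derivations of A ⇒ C and C ⇒ B, first reduce their cuts to atomic or boxed ones using the
-- invertibility of the propositional rules.  A split derivation of A ; ⇒ ; B is then assembled
-- clause by clause: the literals of each clause of C are cut in on the left side, and the clause
-- itself is taken apart on the right side.  Its Maehara interpolant depends, up to equivalence,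
-- only on the CNF of C.  Running the construction for C ; ⇒ ; C and applying soundness of the
-- Maehara interpolant (C → ℳ and ℳ → C) shows that it is equivalent to C.

module Submission where

open import Defs
open import Data.Nat using (ℕ; zero; suc)
open import Data.List using (List; []; _∷_; _++_; map; replicate)
open import Data.List.Properties using (++-assoc; ++-identityʳ; map-++; map-id-local; map-cong-local)
open import Data.List.Relation.Unary.Any using (here; there)
open import Data.List.Relation.Unary.All as All using (All; []; _∷_)
open import Data.List.Relation.Unary.All.Properties using (++⁺; replicate⁺) renaming (map⁺ to All-map⁺)
open import Data.List.Membership.Propositional using (_∈_)
open import Data.List.Membership.Propositional.Properties
  using (∈-∃++; ∈-++⁻; ∈-++⁺ˡ; ∈-++⁺ʳ; ∈-map⁺; ∈-map⁻)
open import Data.List.Relation.Binary.Subset.Propositional using (_⊆_)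
open import Data.List.Relation.Binary.Subset.Propositional.Properties
  using (concatMap⁺; ⊆-respʳ-↭; xs⊆x∷xs)
open import Data.List.Relation.Binary.Permutation.Propositional
  using (_↭_; ↭-refl; ↭-sym; ↭-trans; ↭-reflexive; prep; swap)
open import Data.List.Relation.Binary.Permutation.Propositional.Properties
  using (shift; shifts; drop-∷; ∈-resp-↭; ++⁺ˡ; map⁺; ++-comm)
open import Data.Product using (Σ; ∃; _×_; _,_; proj₁; proj₂)
open import Data.Sum using (_⊎_; inj₁; inj₂)
open import Data.Empty using (⊥; ⊥-elim)
open import Relation.Nullary using (yes; no)
open import Relation.Binary.PropositionalEquality
  using (_≡_; _≢_; refl; sym; trans; cong; cong₂; subst; subst₂)
open import Data.List.Membership.DecPropositional Data.Nat._≟_ using (_∈?_)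

swap-heads : ∀ {x y : Fm} {xs} → x ∷ y ∷ xs ↭ y ∷ x ∷ xs
swap-heads {x} {y} = swap x y ↭-refl

++-[] : ∀ (xs : List Fm) → xs ++ [] ↭ xs
++-[] xs = ↭-reflexive (++-identityʳ xs)

∈-replicate : ∀ {A F : Fm} n → A ∈ replicate n F → A ≡ F
∈-replicate {F = F} n = All.lookup (replicate⁺ {P = _≡ F} n refl)

locate : ∀ n (F A : Fm) {Δ Δ' : List Fm} → A ∷ Δ ↭ replicate n F ++ Δ' →
         (∃ λ n' → n ≡ suc n' × A ≡ F × Δ ↭ replicate n' F ++ Δ') ⊎
         (∃ λ Δ'' → Δ' ↭ A ∷ Δ'' × Δ ↭ replicate n F ++ Δ'')
locate n F A p with ∈-++⁻ (replicate n F) (∈-resp-↭ p (here refl))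
locate (suc n) F A p | inj₁ A∈ with ∈-replicate (suc n) A∈
... | refl = inj₁ (n , refl , refl , drop-∷ p)
locate n F A p | inj₂ A∈ with ∈-∃++ A∈
... | xs , ys , refl = inj₂ (xs ++ ys , shift A xs ys ,
        drop-∷ (↭-trans p (↭-trans (++⁺ˡ (replicate n F) (shift A xs ys))
                                   (shift A (replicate n F) (xs ++ ys)))))

tracked∈ : ∀ {n} {F : Fm} {Δ Δ'} → Δ ↭ replicate (suc n) F ++ Δ' → F ∈ Δ
tracked∈ p = ∈-resp-↭ (↭-sym p) (here refl)

cons-untracked : ∀ n (F A : Fm) {Δ Δ'} → Δ ↭ replicate n F ++ Δ' → A ∷ Δ ↭ replicate n F ++ A ∷ Δ'
cons-untracked n F A {Δ' = Δ'} p = ↭-trans (prep A p) (↭-sym (shift A (replicate n F) Δ'))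

prepend : List Fm → ℕ → List Fm → List Fm
prepend Ξ zero Γ = Γ
prepend Ξ (suc n) Γ = Ξ ++ prepend Ξ n Γ

prepend-shift : ∀ Ξ n (A : Fm) Γ → prepend Ξ n (A ∷ Γ) ↭ A ∷ prepend Ξ n Γ
prepend-shift Ξ zero A Γ = ↭-refl
prepend-shift Ξ (suc n) A Γ = ↭-trans (++⁺ˡ Ξ (prepend-shift Ξ n A Γ)) (shift A Ξ (prepend Ξ n Γ))

prepend⁺ : ∀ Ξ n {Γ Γ'} → Γ ↭ Γ' → prepend Ξ n Γ ↭ prepend Ξ n Γ'
prepend⁺ Ξ zero p = p
prepend⁺ Ξ (suc n) p = ++⁺ˡ Ξ (prepend⁺ Ξ n p)

∈⇒V⊆Vs : ∀ {X Xs} → X ∈ Xs → V X ⊆ Vs Xs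
∈⇒V⊆Vs (here refl) m = ∈-++⁺ˡ m
∈⇒V⊆Vs {Xs = Y ∷ Xs} (there i) m = ∈-++⁺ʳ (V Y) (∈⇒V⊆Vs i m)

Vs-⊆ : ∀ {L} Xs → (∀ {X} → X ∈ Xs → V X ⊆ L) → Vs Xs ⊆ L
Vs-⊆ (X ∷ Xs) h m with ∈-++⁻ (V X) m
... | inj₁ m' = h (here refl) m'
... | inj₂ m' = Vs-⊆ Xs (λ i → h (there i)) m'

++-⊆ : ∀ {L : List ℕ} xs ys → xs ⊆ L → ys ⊆ L → xs ++ ys ⊆ L
++-⊆ xs ys h₁ h₂ m with ∈-++⁻ xs m
... | inj₁ m' = h₁ m'
... | inj₂ m' = h₂ m'

Vs-∷ : ∀ (x : Fm) Γ Δ → Vs (Γ ++ Δ) ⊆ Vs ((x ∷ Γ) ++ Δ)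
Vs-∷ x Γ Δ = ∈-++⁺ʳ (V x)

Vs-insert : ∀ (x : Fm) Γ Δ → Vs (Γ ++ Δ) ⊆ Vs (Γ ++ x ∷ Δ)
Vs-insert x Γ Δ = concatMap⁺ V (⊆-respʳ-↭ (↭-sym (shift x Γ Δ)) (xs⊆x∷xs (Γ ++ Δ) x))

restrict : List ℕ → Fm → Fm
restrict L (at p) with p ∈? L
... | yes _ = at p
... | no _ = ⊥'
restrict L ⊥' = ⊥'
restrict L (A ∧' B) = restrict L A ∧' restrict L B
restrict L (A ∨' B) = restrict L A ∨' restrict L B
restrict L (¬' A) = ¬' (restrict L A)
restrict L (□ A) = □ (restrict L A)

V-restrict : ∀ L X → V (restrict L X) ⊆ L
V-restrict L (at p) with p ∈? L
... | yes m = λ { (here refl) → m }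
... | no _ = λ ()
V-restrict L ⊥' ()
V-restrict L (A ∧' B) = ++-⊆ (V (restrict L A)) _ (V-restrict L A) (V-restrict L B)
V-restrict L (A ∨' B) = ++-⊆ (V (restrict L A)) _ (V-restrict L A) (V-restrict L B)
V-restrict L (¬' A) = V-restrict L A
V-restrict L (□ A) = V-restrict L A

∈-V-restrict : ∀ L X {p} → p ∈ V X → p ∈ L → p ∈ V (restrict L X)
∈-V-restrict L (at q) (here refl) m with q ∈? L
... | yes _ = here refl
... | no n = ⊥-elim (n m)
∈-V-restrict L (A ∧' B) i m with ∈-++⁻ (V A) i
... | inj₁ i' = ∈-++⁺ˡ (∈-V-restrict L A i' m)
... | inj₂ i' = ∈-++⁺ʳ (V (restrict L A)) (∈-V-restrict L B i' m)
∈-V-restrict L (A ∨' B) i m with ∈-++⁻ (V A) i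
... | inj₁ i' = ∈-++⁺ˡ (∈-V-restrict L A i' m)
... | inj₂ i' = ∈-++⁺ʳ (V (restrict L A)) (∈-V-restrict L B i' m)
∈-V-restrict L (¬' A) i m = ∈-V-restrict L A i m
∈-V-restrict L (□ A) i m = ∈-V-restrict L A i m

restrict-cong : ∀ L L' X → (∀ {p} → p ∈ V X → p ∈ L → p ∈ L') → L' ⊆ L →
                restrict L' X ≡ restrict L X
restrict-cong L L' (at p) h s with p ∈? L' | p ∈? L
... | yes _ | yes _ = refl
... | no _ | no _ = refl
... | yes m | no n = ⊥-elim (n (s m))
... | no n | yes m = ⊥-elim (n (h (here refl) m))
restrict-cong L L' ⊥' h s = refl
restrict-cong L L' (A ∧' B) h s =
  cong₂ _∧'_ (restrict-cong L L' A (λ i → h (∈-++⁺ˡ i)) s) (restrict-cong L L' B (λ i → h (∈-++⁺ʳ (V A) i)) s)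
restrict-cong L L' (A ∨' B) h s =
  cong₂ _∨'_ (restrict-cong L L' A (λ i → h (∈-++⁺ˡ i)) s) (restrict-cong L L' B (λ i → h (∈-++⁺ʳ (V A) i)) s)
restrict-cong L L' (¬' A) h s = cong ¬' (restrict-cong L L' A h s)
restrict-cong L L' (□ A) h s = cong □ (restrict-cong L L' A h s)

restrict-id : ∀ L X → V X ⊆ L → restrict L X ≡ X
restrict-id L (at p) h with p ∈? L
... | yes _ = refl
... | no n = ⊥-elim (n (h (here refl)))
restrict-id L ⊥' h = refl
restrict-id L (A ∧' B) h =
  cong₂ _∧'_ (restrict-id L A (λ i → h (∈-++⁺ˡ i))) (restrict-id L B (λ i → h (∈-++⁺ʳ (V A) i)))
restrict-id L (A ∨' B) h =
  cong₂ _∨'_ (restrict-id L A (λ i → h (∈-++⁺ˡ i))) (restrict-id L B (λ i → h (∈-++⁺ʳ (V A) i)))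
restrict-id L (¬' A) h = cong ¬' (restrict-id L A h)
restrict-id L (□ A) h = cong □ (restrict-id L A h)

map-restrict-□s : ∀ L Γ → map (restrict L) (□s Γ) ≡ □s (map (restrict L) Γ)
map-restrict-□s L [] = refl
map-restrict-□s L (X ∷ Γ) = cong (□ (restrict L X) ∷_) (map-restrict-□s L Γ)

restrict-AtomicOrBoxed : ∀ L {A} → AtomicOrBoxed A → AtomicOrBoxed (restrict L A)
restrict-AtomicOrBoxed L (cf-at p) with p ∈? L
... | yes _ = cf-at p
... | no _ = cf-⊥
restrict-AtomicOrBoxed L cf-⊥ = cf-⊥
restrict-AtomicOrBoxed L cf-⊤ = cf-⊤
restrict-AtomicOrBoxed L (cf-□ D) = cf-□ (restrict L D)

Vs-map-restrict : ∀ L Ξ → Vs (map (restrict L) Ξ) ⊆ L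
Vs-map-restrict L Ξ = Vs-⊆ (map (restrict L) Ξ) λ i → restricted (∈-map⁻ (restrict L) i)
  where
  restricted : ∀ {Y} → ∃ (λ Z → Z ∈ Ξ × Y ≡ restrict L Z) → V Y ⊆ L
  restricted (Z , _ , refl) = V-restrict L Z

restrict-to-remaining : ∀ L Ξ {X} → X ∈ Ξ → restrict (Vs (map (restrict L) Ξ)) X ≡ restrict L X
restrict-to-remaining L Ξ {X} X∈Ξ = restrict-cong L _ X remains (Vs-map-restrict L Ξ)
  where
  remains : ∀ {p} → p ∈ V X → p ∈ L → p ∈ Vs (map (restrict L) Ξ)
  remains i m = ∈⇒V⊆Vs (∈-map⁺ (restrict L) X∈Ξ) (∈-V-restrict L X i m)

data Elementary : Fm → Set where
  atom : ∀ p → Elementary (at p)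
  bot  : Elementary ⊥'
  box  : ∀ A → Elementary (□ A)

Elementary⇒AtomicOrBoxed : ∀ {a} → Elementary a → AtomicOrBoxed a
Elementary⇒AtomicOrBoxed (atom p) = cf-at p
Elementary⇒AtomicOrBoxed bot = cf-⊥
Elementary⇒AtomicOrBoxed (box A) = cf-□ A

data Lit : Set where
  pos neg : Fm → Lit

base : Lit → Fm
base (pos a) = a
base (neg a) = a

⟦_⟧ℓ : Lit → Fm
⟦ pos a ⟧ℓ = a
⟦ neg a ⟧ℓ = ¬' a

Clause : Set
Clause = List Lit

⟦_⟧c : Clause → Fm
⟦ [] ⟧c = ⊥'
⟦ ℓ ∷ c ⟧c = ⟦ ℓ ⟧ℓ ∨' ⟦ c ⟧c

lits : Clause → List Fm
lits = map ⟦_⟧ℓ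

clauses : List Clause → List Fm
clauses = map ⟦_⟧c

_⊗_ : List Clause → List Clause → List Clause
[] ⊗ ds = []
(c ∷ cs) ⊗ ds = map (c ++_) ds ++ (cs ⊗ ds)

All-⊗ : ∀ {Q : Clause → Set} cs ds → All (λ c → All (λ d → Q (c ++ d)) ds) cs → All Q (cs ⊗ ds)
All-⊗ [] ds [] = []
All-⊗ (c ∷ cs) ds (h ∷ hs) = ++⁺ (All-map⁺ h) (All-⊗ cs ds hs)

-- cnf⁺ A and cnf⁻ A are conjunctive normal forms of A and of ¬ A.
cnf⁺ cnf⁻ : Fm → List Clause
cnf⁺ (at p) = (pos (at p) ∷ []) ∷ []
cnf⁺ ⊥' = (pos ⊥' ∷ []) ∷ []
cnf⁺ (□ A) = (pos (□ A) ∷ []) ∷ []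
cnf⁺ (X ∧' Y) = cnf⁺ X ++ cnf⁺ Y
cnf⁺ (X ∨' Y) = cnf⁺ X ⊗ cnf⁺ Y
cnf⁺ (¬' X) = cnf⁻ X
cnf⁻ (at p) = (neg (at p) ∷ []) ∷ []
cnf⁻ ⊥' = (neg ⊥' ∷ []) ∷ []
cnf⁻ (□ A) = (neg (□ A) ∷ []) ∷ []
cnf⁻ (X ∧' Y) = cnf⁻ X ⊗ cnf⁻ Y
cnf⁻ (X ∨' Y) = cnf⁻ X ++ cnf⁻ Y
cnf⁻ (¬' X) = cnf⁺ X

ElementaryOver : List ℕ → Lit → Set
ElementaryOver S ℓ = Elementary (base ℓ) × V (base ℓ) ⊆ S

cnf⁺-elementary : ∀ C {S} → V C ⊆ S → All (All (ElementaryOver S)) (cnf⁺ C)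
cnf⁻-elementary : ∀ C {S} → V C ⊆ S → All (All (ElementaryOver S)) (cnf⁻ C)
cnf⁺-elementary (at p) h = ((atom p , h) ∷ []) ∷ []
cnf⁺-elementary ⊥' h = ((bot , h) ∷ []) ∷ []
cnf⁺-elementary (□ A) h = ((box A , h) ∷ []) ∷ []
cnf⁺-elementary (X ∧' Y) h =
  ++⁺ (cnf⁺-elementary X (λ m → h (∈-++⁺ˡ m))) (cnf⁺-elementary Y (λ m → h (∈-++⁺ʳ (V X) m)))
cnf⁺-elementary (X ∨' Y) h = All-⊗ (cnf⁺ X) (cnf⁺ Y)
  (All.map (λ ec → All.map (++⁺ ec) (cnf⁺-elementary Y (λ m → h (∈-++⁺ʳ (V X) m))))
           (cnf⁺-elementary X (λ m → h (∈-++⁺ˡ m))))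
cnf⁺-elementary (¬' X) h = cnf⁻-elementary X h
cnf⁻-elementary (at p) h = ((atom p , h) ∷ []) ∷ []
cnf⁻-elementary ⊥' h = ((bot , h) ∷ []) ∷ []
cnf⁻-elementary (□ A) h = ((box A , h) ∷ []) ∷ []
cnf⁻-elementary (X ∨' Y) h =
  ++⁺ (cnf⁻-elementary X (λ m → h (∈-++⁺ˡ m))) (cnf⁻-elementary Y (λ m → h (∈-++⁺ʳ (V X) m)))
cnf⁻-elementary (X ∧' Y) h = All-⊗ (cnf⁻ X) (cnf⁻ Y)
  (All.map (λ ec → All.map (++⁺ ec) (cnf⁻-elementary Y (λ m → h (∈-++⁺ʳ (V X) m))))
           (cnf⁻-elementary X (λ m → h (∈-++⁺ˡ m))))
cnf⁻-elementary (¬' X) h = cnf⁺-elementary X h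

clause-interpolant : Clause → Fm → Fm
clause-interpolant [] E = ⊥'
clause-interpolant (pos a ∷ D) E = clause-interpolant D E ∨' (a ∧' E)
clause-interpolant (neg a ∷ D) E = (E ∧' ¬' a) ∨' clause-interpolant D E

cnf-interpolant : List Clause → Fm
cnf-interpolant [] = ⊤'
cnf-interpolant (D ∷ Ds) = clause-interpolant D (cnf-interpolant Ds)

module _ (G : Logic) where

  data RPrf : List Fm → List Fm → Set where
    ax-at : ∀ p → RPrf (at p ∷ []) (at p ∷ [])
    ax-□  : ∀ A → RPrf (□ A ∷ []) (□ A ∷ [])
    ax-⊥  : RPrf (⊥' ∷ []) []
    exch  : ∀ {Γ Γ' Δ Δ'} → Γ ↭ Γ' → Δ ↭ Δ' → RPrf Γ Δ → RPrf Γ' Δ'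
    wL    : ∀ {Γ Δ} A → RPrf Γ Δ → RPrf (A ∷ Γ) Δ
    wR    : ∀ {Γ Δ} A → RPrf Γ Δ → RPrf Γ (A ∷ Δ)
    cL    : ∀ {Γ Δ A} → RPrf (A ∷ A ∷ Γ) Δ → RPrf (A ∷ Γ) Δ
    cR    : ∀ {Γ Δ A} → RPrf Γ (A ∷ A ∷ Δ) → RPrf Γ (A ∷ Δ)
    L∧₁   : ∀ {Γ Δ A} B → RPrf (A ∷ Γ) Δ → RPrf (A ∧' B ∷ Γ) Δ
    L∧₂   : ∀ {Γ Δ B} A → RPrf (B ∷ Γ) Δ → RPrf (A ∧' B ∷ Γ) Δ
    R∧    : ∀ {Γ Δ A B} → RPrf Γ (A ∷ Δ) → RPrf Γ (B ∷ Δ) → RPrf Γ (A ∧' B ∷ Δ)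
    R∨₁   : ∀ {Γ Δ A} B → RPrf Γ (A ∷ Δ) → RPrf Γ (A ∨' B ∷ Δ)
    R∨₂   : ∀ {Γ Δ B} A → RPrf Γ (B ∷ Δ) → RPrf Γ (A ∨' B ∷ Δ)
    L∨    : ∀ {Γ Δ A B} → RPrf (A ∷ Γ) Δ → RPrf (B ∷ Γ) Δ → RPrf (A ∨' B ∷ Γ) Δ
    L¬    : ∀ {Γ Δ A} → RPrf Γ (A ∷ Δ) → RPrf (¬' A ∷ Γ) Δ
    R¬    : ∀ {Γ Δ A} → RPrf (A ∷ Γ) Δ → RPrf Γ (¬' A ∷ Δ)
    cut   : ∀ {Γ Δ} A → AtomicOrBoxed A → RPrf Γ (A ∷ Δ) → RPrf (A ∷ Γ) Δ → RPrf Γ Δ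
    ruleK : ∀ {Γ A} → HasK G → RPrf Γ (A ∷ []) → RPrf (□s Γ) (□ A ∷ [])
    ruleD : ∀ {Γ} → HasD G → RPrf Γ [] → RPrf (□s Γ) []
    rule4 : ∀ {Γ A} → Has4 G → RPrf (Γ ++ □s Γ) (A ∷ []) → RPrf (□s Γ) (□ A ∷ [])
    ruleT : ∀ {Γ Δ A} → HasT G → RPrf (A ∷ Γ) Δ → RPrf (□ A ∷ Γ) Δ

  exL : ∀ {Γ Γ' Δ} → Γ ↭ Γ' → RPrf Γ Δ → RPrf Γ' Δ
  exL p = exch p ↭-refl

  exR : ∀ {Γ Δ Δ'} → Δ ↭ Δ' → RPrf Γ Δ → RPrf Γ Δ'
  exR p = exch ↭-refl p

  wL* : ∀ Ξ {Γ Δ} → RPrf Γ Δ → RPrf (Ξ ++ Γ) Δ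
  wL* [] π = π
  wL* (x ∷ Ξ) π = wL x (wL* Ξ π)

  wR* : ∀ Ξ {Γ Δ} → RPrf Γ Δ → RPrf Γ (Ξ ++ Δ)
  wR* [] π = π
  wR* (x ∷ Ξ) π = wR x (wR* Ξ π)

  double-shift : ∀ (x : Fm) Ξ Γ → Ξ ++ Ξ ++ x ∷ Γ ↭ x ∷ Ξ ++ Ξ ++ Γ
  double-shift x Ξ Γ = ↭-trans (++⁺ˡ Ξ (shift x Ξ Γ)) (shift x Ξ (Ξ ++ Γ))

  cL* : ∀ Ξ {Γ Δ} → RPrf (Ξ ++ Ξ ++ Γ) Δ → RPrf (Ξ ++ Γ) Δ
  cL* [] π = π
  cL* (x ∷ Ξ) {Γ} π =
    exL (shift x Ξ Γ) (cL* Ξ (exL (↭-sym (double-shift x Ξ Γ)) (cL (exL (prep x (shift x Ξ (Ξ ++ Γ))) π))))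

  cR* : ∀ Ξ {Γ Δ} → RPrf Γ (Ξ ++ Ξ ++ Δ) → RPrf Γ (Ξ ++ Δ)
  cR* [] π = π
  cR* (x ∷ Ξ) {Δ = Δ} π =
    exR (shift x Ξ Δ) (cR* Ξ (exR (↭-sym (double-shift x Ξ Δ)) (cR (exR (prep x (shift x Ξ (Ξ ++ Δ))) π))))

  record RightInvertible (F : Fm) (Γ⁺ Δ⁺ : List Fm) : Set where
    field
      R∧-premises : ∀ {Γ Δ A B} → A ∧' B ≡ F → RPrf Γ (A ∷ Δ) → RPrf Γ (B ∷ Δ) → RPrf (Γ⁺ ++ Γ) (Δ⁺ ++ Δ)
      R∨₁-premise : ∀ {Γ Δ A B} → A ∨' B ≡ F → RPrf Γ (A ∷ Δ) → RPrf (Γ⁺ ++ Γ) (Δ⁺ ++ Δ)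
      R∨₂-premise : ∀ {Γ Δ A B} → A ∨' B ≡ F → RPrf Γ (B ∷ Δ) → RPrf (Γ⁺ ++ Γ) (Δ⁺ ++ Δ)
      R¬-premise  : ∀ {Γ Δ A} → ¬' A ≡ F → RPrf (A ∷ Γ) Δ → RPrf (Γ⁺ ++ Γ) (Δ⁺ ++ Δ)
      not-atom    : ∀ p → at p ≢ F
      not-box     : ∀ A → □ A ≢ F

  record LeftInvertible (F : Fm) (Γ⁺ Δ⁺ : List Fm) : Set where
    field
      L∧₁-premise : ∀ {Γ Δ A B} → A ∧' B ≡ F → RPrf (A ∷ Γ) Δ → RPrf (Γ⁺ ++ Γ) (Δ⁺ ++ Δ)
      L∧₂-premise : ∀ {Γ Δ A B} → A ∧' B ≡ F → RPrf (B ∷ Γ) Δ → RPrf (Γ⁺ ++ Γ) (Δ⁺ ++ Δ)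
      L∨-premises : ∀ {Γ Δ A B} → A ∨' B ≡ F → RPrf (A ∷ Γ) Δ → RPrf (B ∷ Γ) Δ → RPrf (Γ⁺ ++ Γ) (Δ⁺ ++ Δ)
      L¬-premise  : ∀ {Γ Δ A} → ¬' A ≡ F → RPrf Γ (A ∷ Δ) → RPrf (Γ⁺ ++ Γ) (Δ⁺ ++ Δ)
      not-atom    : ∀ p → at p ≢ F
      not-box     : ∀ A → □ A ≢ F
      not-⊥       : ⊥' ≢ F

  module Stacks (Γ⁺ Δ⁺ : List Fm) where
    inL : ∀ n {A Γ Δ} → RPrf (A ∷ prepend Γ⁺ n Γ) Δ → RPrf (prepend Γ⁺ n (A ∷ Γ)) Δ
    inL n {A} {Γ} = exL (↭-sym (prepend-shift Γ⁺ n A Γ))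

    outL : ∀ n {A Γ Δ} → RPrf (prepend Γ⁺ n (A ∷ Γ)) Δ → RPrf (A ∷ prepend Γ⁺ n Γ) Δ
    outL n {A} {Γ} = exL (prepend-shift Γ⁺ n A Γ)

    outL₂ : ∀ n {A B Γ Δ} → RPrf (prepend Γ⁺ n (A ∷ B ∷ Γ)) Δ → RPrf (A ∷ B ∷ prepend Γ⁺ n Γ) Δ
    outL₂ n {A} {B} {Γ} = exL (↭-trans (prepend-shift Γ⁺ n A (B ∷ Γ)) (prep A (prepend-shift Γ⁺ n B Γ)))

    inL-↭ : ∀ n {A Γ Γ' Δ} → Γ' ↭ A ∷ Γ → RPrf (A ∷ prepend Γ⁺ n Γ) Δ → RPrf (prepend Γ⁺ n Γ') Δ
    inL-↭ n q π = exL (prepend⁺ Γ⁺ n (↭-sym q)) (inL n π)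

    inR : ∀ n {A Γ Δ} → RPrf Γ (A ∷ prepend Δ⁺ n Δ) → RPrf Γ (prepend Δ⁺ n (A ∷ Δ))
    inR n {A} {Δ = Δ} = exR (↭-sym (prepend-shift Δ⁺ n A Δ))

    outR : ∀ n {A Γ Δ} → RPrf Γ (prepend Δ⁺ n (A ∷ Δ)) → RPrf Γ (A ∷ prepend Δ⁺ n Δ)
    outR n {A} {Δ = Δ} = exR (prepend-shift Δ⁺ n A Δ)

    outR₂ : ∀ n {A B Γ Δ} → RPrf Γ (prepend Δ⁺ n (A ∷ B ∷ Δ)) → RPrf Γ (A ∷ B ∷ prepend Δ⁺ n Δ)
    outR₂ n {A} {B} {Δ = Δ} = exR (↭-trans (prepend-shift Δ⁺ n A (B ∷ Δ)) (prep A (prepend-shift Δ⁺ n B Δ)))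

    inR-↭ : ∀ n {A Γ Δ Δ'} → Δ' ↭ A ∷ Δ → RPrf Γ (A ∷ prepend Δ⁺ n Δ) → RPrf Γ (prepend Δ⁺ n Δ')
    inR-↭ n q π = exR (prepend⁺ Δ⁺ n (↭-sym q)) (inR n π)

    weaken-block : ∀ n {Γ Δ} → RPrf (prepend Γ⁺ n Γ) (prepend Δ⁺ n Δ) →
                   RPrf (prepend Γ⁺ (suc n) Γ) (prepend Δ⁺ (suc n) Δ)
    weaken-block n π = wL* Γ⁺ (wR* Δ⁺ π)

    contract-block : ∀ n {Γ Δ} → RPrf (prepend Γ⁺ (suc (suc n)) Γ) (prepend Δ⁺ (suc (suc n)) Δ) →
                     RPrf (prepend Γ⁺ (suc n) Γ) (prepend Δ⁺ (suc n) Δ)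
    contract-block n π = cL* Γ⁺ (cR* Δ⁺ π)

  -- Inversion is proved for n tracked copies of F at once, so that contraction on F goes through.
  module RightInversion {F Γ⁺ Δ⁺} (H : RightInvertible F Γ⁺ Δ⁺) where
    open RightInvertible H
    open Stacks Γ⁺ Δ⁺

    invert : ∀ n {Γ Δ Δ'} → RPrf Γ Δ → Δ ↭ replicate n F ++ Δ' → RPrf (prepend Γ⁺ n Γ) (prepend Δ⁺ n Δ')
    invert zero π p = exR p π
    invert (suc k) (ax-at q) p with tracked∈ {k} p
    ... | here e = ⊥-elim (not-atom q (sym e))
    invert (suc k) (ax-□ A) p with tracked∈ {k} p
    ... | here e = ⊥-elim (not-box A (sym e))
    invert (suc k) ax-⊥ p with tracked∈ {k} p
    ... | ()
    invert (suc k) (ruleK _ _) p with tracked∈ {k} p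
    ... | here e = ⊥-elim (not-box _ (sym e))
    invert (suc k) (rule4 _ _) p with tracked∈ {k} p
    ... | here e = ⊥-elim (not-box _ (sym e))
    invert (suc k) (ruleD _ _) p with tracked∈ {k} p
    ... | ()
    invert n@(suc _) (exch q r π) p = exL (prepend⁺ Γ⁺ n q) (invert n π (↭-trans r p))
    invert n@(suc _) (wL A π) p = inL n (wL A (invert n π p))
    invert n@(suc _) (cL π) p = inL n (cL (outL₂ n (invert n π p)))
    invert n@(suc _) (L∧₁ B π) p = inL n (L∧₁ B (outL n (invert n π p)))
    invert n@(suc _) (L∧₂ A π) p = inL n (L∧₂ A (outL n (invert n π p)))
    invert n@(suc _) (L∨ π₁ π₂) p = inL n (L∨ (outL n (invert n π₁ p)) (outL n (invert n π₂ p)))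
    invert n@(suc _) (ruleT h π) p = inL n (ruleT h (outL n (invert n π p)))
    invert n@(suc _) (L¬ {A = A} π) p = inL n (L¬ (outR n (invert n π (cons-untracked n F A p))))
    invert n@(suc _) (cut A ok π₁ π₂) p =
      cut A ok (outR n (invert n π₁ (cons-untracked n F A p))) (outL n (invert n π₂ p))
    invert n@(suc _) (wR A π) p with locate n F A p
    ... | inj₁ (k , refl , refl , q) = weaken-block k (invert k π q)
    ... | inj₂ (_ , q₁ , q₂) = inR-↭ n q₁ (wR A (invert n π q₂))
    invert n@(suc _) (cR {A = A} π) p with locate n F A p
    ... | inj₁ (k , refl , refl , q) = contract-block k (invert (suc (suc k)) π (prep A (prep A q)))
    ... | inj₂ (_ , q₁ , q₂) =
      inR-↭ n q₁ (cR (outR₂ n (invert n π (cons-untracked n F A (cons-untracked n F A q₂)))))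
    invert n@(suc _) (R¬ {A = A} π) p with locate n F (¬' A) p
    ... | inj₁ (k , refl , e , q) = R¬-premise e (outL k (invert k π q))
    ... | inj₂ (_ , q₁ , q₂) = inR-↭ n q₁ (R¬ (outL n (invert n π q₂)))
    invert n@(suc _) (R∧ {A = A} {B} π₁ π₂) p with locate n F (A ∧' B) p
    ... | inj₁ (k , refl , e , q) =
      R∧-premises e (outR k (invert k π₁ (cons-untracked k F A q)))
                    (outR k (invert k π₂ (cons-untracked k F B q)))
    ... | inj₂ (_ , q₁ , q₂) =
      inR-↭ n q₁ (R∧ (outR n (invert n π₁ (cons-untracked n F A q₂)))
                     (outR n (invert n π₂ (cons-untracked n F B q₂))))
    invert n@(suc _) (R∨₁ {A = A} B π) p with locate n F (A ∨' B) p
    ... | inj₁ (k , refl , e , q) = R∨₁-premise e (outR k (invert k π (cons-untracked k F A q)))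
    ... | inj₂ (_ , q₁ , q₂) = inR-↭ n q₁ (R∨₁ B (outR n (invert n π (cons-untracked n F A q₂))))
    invert n@(suc _) (R∨₂ {B = B} A π) p with locate n F (A ∨' B) p
    ... | inj₁ (k , refl , e , q) = R∨₂-premise e (outR k (invert k π (cons-untracked k F B q)))
    ... | inj₂ (_ , q₁ , q₂) = inR-↭ n q₁ (R∨₂ A (outR n (invert n π (cons-untracked n F B q₂))))

  module LeftInversion {F Γ⁺ Δ⁺} (H : LeftInvertible F Γ⁺ Δ⁺) where
    open LeftInvertible H
    open Stacks Γ⁺ Δ⁺

    boxed-∉ : ∀ Γ → F ∈ □s Γ → ⊥
    boxed-∉ Γ m with ∈-map⁻ □ m
    ... | A , _ , e = not-box A (sym e)

    invert : ∀ n {Γ Γ' Δ} → RPrf Γ Δ → Γ ↭ replicate n F ++ Γ' → RPrf (prepend Γ⁺ n Γ') (prepend Δ⁺ n Δ)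
    invert zero π p = exL p π
    invert (suc k) (ax-at q) p with tracked∈ {k} p
    ... | here e = ⊥-elim (not-atom q (sym e))
    invert (suc k) (ax-□ A) p with tracked∈ {k} p
    ... | here e = ⊥-elim (not-box A (sym e))
    invert (suc k) ax-⊥ p with tracked∈ {k} p
    ... | here e = ⊥-elim (not-⊥ (sym e))
    invert (suc k) (ruleK {Γ} _ _) p = ⊥-elim (boxed-∉ Γ (tracked∈ {k} p))
    invert (suc k) (rule4 {Γ} _ _) p = ⊥-elim (boxed-∉ Γ (tracked∈ {k} p))
    invert (suc k) (ruleD {Γ} _ _) p = ⊥-elim (boxed-∉ Γ (tracked∈ {k} p))
    invert n@(suc _) (exch q r π) p = exR (prepend⁺ Δ⁺ n r) (invert n π (↭-trans q p))
    invert n@(suc _) (wR A π) p = inR n (wR A (invert n π p))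
    invert n@(suc _) (cR π) p = inR n (cR (outR₂ n (invert n π p)))
    invert n@(suc _) (R∧ π₁ π₂) p = inR n (R∧ (outR n (invert n π₁ p)) (outR n (invert n π₂ p)))
    invert n@(suc _) (R∨₁ B π) p = inR n (R∨₁ B (outR n (invert n π p)))
    invert n@(suc _) (R∨₂ A π) p = inR n (R∨₂ A (outR n (invert n π p)))
    invert n@(suc _) (R¬ {A = A} π) p = inR n (R¬ (outL n (invert n π (cons-untracked n F A p))))
    invert n@(suc _) (cut A ok π₁ π₂) p =
      cut A ok (outR n (invert n π₁ p)) (outL n (invert n π₂ (cons-untracked n F A p)))
    invert n@(suc _) (wL A π) p with locate n F A p
    ... | inj₁ (k , refl , refl , q) = weaken-block k (invert k π q)
    ... | inj₂ (_ , q₁ , q₂) = inL-↭ n q₁ (wL A (invert n π q₂))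
    invert n@(suc _) (cL {A = A} π) p with locate n F A p
    ... | inj₁ (k , refl , refl , q) = contract-block k (invert (suc (suc k)) π (prep A (prep A q)))
    ... | inj₂ (_ , q₁ , q₂) =
      inL-↭ n q₁ (cL (outL₂ n (invert n π (cons-untracked n F A (cons-untracked n F A q₂)))))
    invert n@(suc _) (ruleT {A = A} h π) p with locate n F (□ A) p
    ... | inj₁ (_ , refl , e , _) = ⊥-elim (not-box A e)
    ... | inj₂ (_ , q₁ , q₂) = inL-↭ n q₁ (ruleT h (outL n (invert n π (cons-untracked n F A q₂))))
    invert n@(suc _) (L¬ {A = A} π) p with locate n F (¬' A) p
    ... | inj₁ (k , refl , e , q) = L¬-premise e (outR k (invert k π q))
    ... | inj₂ (_ , q₁ , q₂) = inL-↭ n q₁ (L¬ (outR n (invert n π q₂)))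
    invert n@(suc _) (L∧₁ {A = A} B π) p with locate n F (A ∧' B) p
    ... | inj₁ (k , refl , e , q) = L∧₁-premise e (outL k (invert k π (cons-untracked k F A q)))
    ... | inj₂ (_ , q₁ , q₂) = inL-↭ n q₁ (L∧₁ B (outL n (invert n π (cons-untracked n F A q₂))))
    invert n@(suc _) (L∧₂ {B = B} A π) p with locate n F (A ∧' B) p
    ... | inj₁ (k , refl , e , q) = L∧₂-premise e (outL k (invert k π (cons-untracked k F B q)))
    ... | inj₂ (_ , q₁ , q₂) = inL-↭ n q₁ (L∧₂ A (outL n (invert n π (cons-untracked n F B q₂))))
    invert n@(suc _) (L∨ {A = A} {B} π₁ π₂) p with locate n F (A ∨' B) p
    ... | inj₁ (k , refl , e , q) =
      L∨-premises e (outL k (invert k π₁ (cons-untracked k F A q)))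
                    (outL k (invert k π₂ (cons-untracked k F B q)))
    ... | inj₂ (_ , q₁ , q₂) =
      inL-↭ n q₁ (L∨ (outL n (invert n π₁ (cons-untracked n F A q₂)))
                     (outL n (invert n π₂ (cons-untracked n F B q₂))))

  invert-R : ∀ {F Γ⁺ Δ⁺ Γ Δ} → RightInvertible F Γ⁺ Δ⁺ → RPrf Γ (F ∷ Δ) → RPrf (Γ⁺ ++ Γ) (Δ⁺ ++ Δ)
  invert-R H π = RightInversion.invert H 1 π ↭-refl

  invert-L : ∀ {F Γ⁺ Δ⁺ Γ Δ} → LeftInvertible F Γ⁺ Δ⁺ → RPrf (F ∷ Γ) Δ → RPrf (Γ⁺ ++ Γ) (Δ⁺ ++ Δ)
  invert-L H π = LeftInversion.invert H 1 π ↭-refl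

  R∧-inv₁ : ∀ {Γ Δ} X Y → RPrf Γ (X ∧' Y ∷ Δ) → RPrf Γ (X ∷ Δ)
  R∧-inv₁ X Y = invert-R {Γ⁺ = []} {Δ⁺ = X ∷ []} record
    { R∧-premises = λ { refl p _ → p } ; R∨₁-premise = λ () ; R∨₂-premise = λ () ; R¬-premise = λ ()
    ; not-atom = λ _ () ; not-box = λ _ () }

  R∧-inv₂ : ∀ {Γ Δ} X Y → RPrf Γ (X ∧' Y ∷ Δ) → RPrf Γ (Y ∷ Δ)
  R∧-inv₂ X Y = invert-R {Γ⁺ = []} {Δ⁺ = Y ∷ []} record
    { R∧-premises = λ { refl _ q → q } ; R∨₁-premise = λ () ; R∨₂-premise = λ () ; R¬-premise = λ ()
    ; not-atom = λ _ () ; not-box = λ _ () }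

  R∨-inv : ∀ {Γ Δ} X Y → RPrf Γ (X ∨' Y ∷ Δ) → RPrf Γ (X ∷ Y ∷ Δ)
  R∨-inv X Y = invert-R {Γ⁺ = []} {Δ⁺ = X ∷ Y ∷ []} record
    { R∧-premises = λ () ; R∨₁-premise = λ { refl p → exR swap-heads (wR Y p) }
    ; R∨₂-premise = λ { refl p → wR X p } ; R¬-premise = λ () ; not-atom = λ _ () ; not-box = λ _ () }

  R¬-inv : ∀ {Γ Δ} X → RPrf Γ (¬' X ∷ Δ) → RPrf (X ∷ Γ) Δ
  R¬-inv X = invert-R {Γ⁺ = X ∷ []} {Δ⁺ = []} record
    { R∧-premises = λ () ; R∨₁-premise = λ () ; R∨₂-premise = λ () ; R¬-premise = λ { refl p → p }
    ; not-atom = λ _ () ; not-box = λ _ () }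

  L∧-inv : ∀ {Γ Δ} X Y → RPrf (X ∧' Y ∷ Γ) Δ → RPrf (X ∷ Y ∷ Γ) Δ
  L∧-inv X Y = invert-L {Γ⁺ = X ∷ Y ∷ []} {Δ⁺ = []} record
    { L∧₁-premise = λ { refl p → exL swap-heads (wL Y p) } ; L∧₂-premise = λ { refl p → wL X p }
    ; L∨-premises = λ () ; L¬-premise = λ () ; not-atom = λ _ () ; not-box = λ _ () ; not-⊥ = λ () }

  L∨-inv₁ : ∀ {Γ Δ} X Y → RPrf (X ∨' Y ∷ Γ) Δ → RPrf (X ∷ Γ) Δ
  L∨-inv₁ X Y = invert-L {Γ⁺ = X ∷ []} {Δ⁺ = []} record
    { L∧₁-premise = λ () ; L∧₂-premise = λ () ; L∨-premises = λ { refl p _ → p } ; L¬-premise = λ ()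
    ; not-atom = λ _ () ; not-box = λ _ () ; not-⊥ = λ () }

  L∨-inv₂ : ∀ {Γ Δ} X Y → RPrf (X ∨' Y ∷ Γ) Δ → RPrf (Y ∷ Γ) Δ
  L∨-inv₂ X Y = invert-L {Γ⁺ = Y ∷ []} {Δ⁺ = []} record
    { L∧₁-premise = λ () ; L∧₂-premise = λ () ; L∨-premises = λ { refl _ q → q } ; L¬-premise = λ ()
    ; not-atom = λ _ () ; not-box = λ _ () ; not-⊥ = λ () }

  L¬-inv : ∀ {Γ Δ} X → RPrf (¬' X ∷ Γ) Δ → RPrf Γ (X ∷ Δ)
  L¬-inv X = invert-L {Γ⁺ = []} {Δ⁺ = X ∷ []} record
    { L∧₁-premise = λ () ; L∧₂-premise = λ () ; L∨-premises = λ () ; L¬-premise = λ { refl p → p }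
    ; not-atom = λ _ () ; not-box = λ _ () ; not-⊥ = λ () }

  cut-admissible : ∀ {Γ Δ} A → RPrf Γ (A ∷ Δ) → RPrf (A ∷ Γ) Δ → RPrf Γ Δ
  cut-admissible (at p) π₁ π₂ = cut (at p) (cf-at p) π₁ π₂
  cut-admissible ⊥' π₁ π₂ = cut ⊥' cf-⊥ π₁ π₂
  cut-admissible (□ A) π₁ π₂ = cut (□ A) (cf-□ A) π₁ π₂
  cut-admissible (X ∧' Y) π₁ π₂ =
    cut-admissible X (R∧-inv₁ X Y π₁)
      (cut-admissible Y (wL X (R∧-inv₂ X Y π₁)) (exL swap-heads (L∧-inv X Y π₂)))
  cut-admissible (X ∨' Y) π₁ π₂ =
    cut-admissible Y (cut-admissible X (R∨-inv X Y π₁) (wR Y (L∨-inv₁ X Y π₂))) (L∨-inv₂ X Y π₂)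
  cut-admissible (¬' X) π₁ π₂ = cut-admissible X (L¬-inv X π₂) (R¬-inv X π₁)

  restrict-cuts : ∀ {Γ Δ} → Prf G Γ Δ → RPrf Γ Δ
  restrict-cuts (ax-at p) = ax-at p
  restrict-cuts (ax-□ A) = ax-□ A
  restrict-cuts ax-⊥ = ax-⊥
  restrict-cuts (exch p q π) = exch p q (restrict-cuts π)
  restrict-cuts (wL A π) = wL A (restrict-cuts π)
  restrict-cuts (wR A π) = wR A (restrict-cuts π)
  restrict-cuts (cL π) = cL (restrict-cuts π)
  restrict-cuts (cR π) = cR (restrict-cuts π)
  restrict-cuts (L∧₁ B π) = L∧₁ B (restrict-cuts π)
  restrict-cuts (L∧₂ A π) = L∧₂ A (restrict-cuts π)
  restrict-cuts (R∧ π₁ π₂) = R∧ (restrict-cuts π₁) (restrict-cuts π₂)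
  restrict-cuts (R∨₁ B π) = R∨₁ B (restrict-cuts π)
  restrict-cuts (R∨₂ A π) = R∨₂ A (restrict-cuts π)
  restrict-cuts (L∨ π₁ π₂) = L∨ (restrict-cuts π₁) (restrict-cuts π₂)
  restrict-cuts (L¬ π) = L¬ (restrict-cuts π)
  restrict-cuts (R¬ π) = R¬ (restrict-cuts π)
  restrict-cuts (cut A π₁ π₂) = cut-admissible A (restrict-cuts π₁) (restrict-cuts π₂)
  restrict-cuts (ruleK h π) = ruleK h (restrict-cuts π)
  restrict-cuts (ruleD h π) = ruleD h (restrict-cuts π)
  restrict-cuts (rule4 h π) = rule4 h (restrict-cuts π)
  restrict-cuts (ruleT h π) = ruleT h (restrict-cuts π)

  implication⇒sequent : ∀ {A C} → G ⊢ (A ⊃ C) → RPrf (A ∷ []) (C ∷ [])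
  implication⇒sequent {A} {C} p = R¬-inv A (R∨-inv (¬' A) C (restrict-cuts p))

  Split : List Fm → List Fm → List Fm → List Fm → Set
  Split = SPrf G AtomicOrBoxed

  ℳ : ∀ {Γ₁ Γ₂ Δ₁ Δ₂} → Split Γ₁ Γ₂ Δ₁ Δ₂ → Fm
  ℳ = M G AtomicOrBoxed

  -- Every formula on the left side.  Atoms outside L become ⊥; each cut is translated after
  -- restricting further to the atoms of its conclusion, which gives the variable condition.
  restricted-all-left : ∀ L {Γ Δ} → RPrf Γ Δ → Split (map (restrict L) Γ) [] (map (restrict L) Δ) []
  restricted-all-left L (ax-at p) with p ∈? L
  ... | yes _ = ax-at-ll p
  ... | no _ = wRˡ ⊥' ax-⊥ˡ
  restricted-all-left L (ax-□ A) = ax-□-ll (restrict L A)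
  restricted-all-left L ax-⊥ = ax-⊥ˡ
  restricted-all-left L (exch p q π) =
    exch (map⁺ (restrict L) p) ↭-refl (map⁺ (restrict L) q) ↭-refl (restricted-all-left L π)
  restricted-all-left L (wL A π) = wLˡ (restrict L A) (restricted-all-left L π)
  restricted-all-left L (wR A π) = wRˡ (restrict L A) (restricted-all-left L π)
  restricted-all-left L (cL π) = cLˡ (restricted-all-left L π)
  restricted-all-left L (cR π) = cRˡ (restricted-all-left L π)
  restricted-all-left L (L∧₁ B π) = L∧₁ˡ (restrict L B) (restricted-all-left L π)
  restricted-all-left L (L∧₂ A π) = L∧₂ˡ (restrict L A) (restricted-all-left L π)
  restricted-all-left L (R∧ π₁ π₂) = R∧ˡ (restricted-all-left L π₁) (restricted-all-left L π₂)
  restricted-all-left L (R∨₁ B π) = R∨₁ˡ (restrict L B) (restricted-all-left L π)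
  restricted-all-left L (R∨₂ A π) = R∨₂ˡ (restrict L A) (restricted-all-left L π)
  restricted-all-left L (L∨ π₁ π₂) = L∨ˡ (restricted-all-left L π₁) (restricted-all-left L π₂)
  restricted-all-left L (L¬ π) = L¬ˡ (restricted-all-left L π)
  restricted-all-left L (R¬ π) = R¬ˡ (restricted-all-left L π)
  restricted-all-left L (ruleT h π) = ruleTˡ h (restricted-all-left L π)
  restricted-all-left L (ruleK {Γ} h π) =
    subst (λ Ξ → Split Ξ [] _ []) (sym (map-restrict-□s L Γ)) (ruleKˡ h (restricted-all-left L π))
  restricted-all-left L (ruleD {Γ} h π) =
    subst (λ Ξ → Split Ξ [] _ []) (sym (map-restrict-□s L Γ)) (ruleD h (restricted-all-left L π))
  restricted-all-left L (rule4 {Γ} h π) =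
    subst (λ Ξ → Split Ξ [] _ []) (sym (map-restrict-□s L Γ))
      (rule4ˡ h (subst (λ Ξ → Split Ξ [] _ []) Γ-□Γ (restricted-all-left L π)))
    where
    Γ-□Γ : map (restrict L) (Γ ++ □s Γ) ≡ map (restrict L) Γ ++ □s (map (restrict L) Γ)
    Γ-□Γ = trans (map-++ (restrict L) Γ (□s Γ)) (cong (map (restrict L) Γ ++_) (map-restrict-□s L Γ))
  restricted-all-left L (cut {Γ} {Δ} A ok π₁ π₂) =
    cutˡ (restrict L' A) (restrict-AtomicOrBoxed L' ok) V-cut
      (subst₂ (λ Γ' Δ' → Split Γ' [] (restrict L' A ∷ Δ') []) same-Γ same-Δ (restricted-all-left L' π₁))
      (subst₂ (λ Γ' Δ' → Split (restrict L' A ∷ Γ') [] Δ' []) same-Γ same-Δ (restricted-all-left L' π₂))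
    where
    L' = Vs (map (restrict L) (Γ ++ Δ))
    same-Γ : map (restrict L') Γ ≡ map (restrict L) Γ
    same-Γ = map-cong-local (All.tabulate λ i → restrict-to-remaining L (Γ ++ Δ) (∈-++⁺ˡ i))
    same-Δ : map (restrict L') Δ ≡ map (restrict L) Δ
    same-Δ = map-cong-local (All.tabulate λ i → restrict-to-remaining L (Γ ++ Δ) (∈-++⁺ʳ Γ i))
    V-cut : V (restrict L' A) ⊆ Vs (map (restrict L) Γ ++ map (restrict L) Δ)
    V-cut m = subst (λ Ξ → _ ∈ Vs Ξ) (map-++ (restrict L) Γ Δ) (V-restrict L' A m)

  all-left : ∀ {Γ Δ} → RPrf Γ Δ → Split Γ [] Δ []
  all-left {Γ} {Δ} π =
    subst₂ (λ Γ' Δ' → Split Γ' [] Δ' []) (unchanged (∈-++⁺ˡ)) (unchanged (∈-++⁺ʳ Γ)) (restricted-all-left L π)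
    where
    L = Vs (Γ ++ Δ)
    unchanged : ∀ {Ξ} → (∀ {X} → X ∈ Ξ → X ∈ Γ ++ Δ) → map (restrict L) Ξ ≡ Ξ
    unchanged h = map-id-local (All.tabulate λ {X} i → restrict-id L X (∈⇒V⊆Vs (h i)))

  swap-sides : ∀ {Γ₁ Γ₂ Δ₁ Δ₂} → Split Γ₁ Γ₂ Δ₁ Δ₂ → Split Γ₂ Γ₁ Δ₂ Δ₁
  swap-sides (ax-at-ll p) = ax-at-rr p
  swap-sides (ax-at-rr p) = ax-at-ll p
  swap-sides (ax-at-lr p) = ax-at-rl p
  swap-sides (ax-at-rl p) = ax-at-lr p
  swap-sides (ax-□-ll A) = ax-□-rr A
  swap-sides (ax-□-rr A) = ax-□-ll A
  swap-sides (ax-□-lr A) = ax-□-rl A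
  swap-sides (ax-□-rl A) = ax-□-lr A
  swap-sides ax-⊥ˡ = ax-⊥ʳ
  swap-sides ax-⊥ʳ = ax-⊥ˡ
  swap-sides (exch a b c d π) = exch b a d c (swap-sides π)
  swap-sides (wLˡ A π) = wLʳ A (swap-sides π)
  swap-sides (wLʳ A π) = wLˡ A (swap-sides π)
  swap-sides (wRˡ A π) = wRʳ A (swap-sides π)
  swap-sides (wRʳ A π) = wRˡ A (swap-sides π)
  swap-sides (cLˡ π) = cLʳ (swap-sides π)
  swap-sides (cLʳ π) = cLˡ (swap-sides π)
  swap-sides (cRˡ π) = cRʳ (swap-sides π)
  swap-sides (cRʳ π) = cRˡ (swap-sides π)
  swap-sides (L∧₁ˡ B π) = L∧₁ʳ B (swap-sides π)
  swap-sides (L∧₁ʳ B π) = L∧₁ˡ B (swap-sides π)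
  swap-sides (L∧₂ˡ A π) = L∧₂ʳ A (swap-sides π)
  swap-sides (L∧₂ʳ A π) = L∧₂ˡ A (swap-sides π)
  swap-sides (R∧ˡ π₁ π₂) = R∧ʳ (swap-sides π₁) (swap-sides π₂)
  swap-sides (R∧ʳ π₁ π₂) = R∧ˡ (swap-sides π₁) (swap-sides π₂)
  swap-sides (R∨₁ˡ B π) = R∨₁ʳ B (swap-sides π)
  swap-sides (R∨₁ʳ B π) = R∨₁ˡ B (swap-sides π)
  swap-sides (R∨₂ˡ A π) = R∨₂ʳ A (swap-sides π)
  swap-sides (R∨₂ʳ A π) = R∨₂ˡ A (swap-sides π)
  swap-sides (L∨ˡ π₁ π₂) = L∨ʳ (swap-sides π₁) (swap-sides π₂)
  swap-sides (L∨ʳ π₁ π₂) = L∨ˡ (swap-sides π₁) (swap-sides π₂)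
  swap-sides (L¬ˡ π) = L¬ʳ (swap-sides π)
  swap-sides (L¬ʳ π) = L¬ˡ (swap-sides π)
  swap-sides (R¬ˡ π) = R¬ʳ (swap-sides π)
  swap-sides (R¬ʳ π) = R¬ˡ (swap-sides π)
  swap-sides (cutˡ A ok vc π₁ π₂) = cutʳ A ok vc (swap-sides π₁) (swap-sides π₂)
  swap-sides (cutʳ A ok vc π₁ π₂) = cutˡ A ok vc (swap-sides π₁) (swap-sides π₂)
  swap-sides (ruleKˡ h π) = ruleKʳ h (swap-sides π)
  swap-sides (ruleKʳ h π) = ruleKˡ h (swap-sides π)
  swap-sides (ruleD h π) = ruleD h (swap-sides π)
  swap-sides (rule4ˡ h π) = rule4ʳ h (swap-sides π)
  swap-sides (rule4ʳ h π) = rule4ˡ h (swap-sides π)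
  swap-sides (ruleTˡ h π) = ruleTʳ h (swap-sides π)
  swap-sides (ruleTʳ h π) = ruleTˡ h (swap-sides π)

  swapL : ∀ {A B Γ Δ} → Prf G (A ∷ B ∷ Γ) Δ → Prf G (B ∷ A ∷ Γ) Δ
  swapL = exch swap-heads ↭-refl

  swapR : ∀ {A B Γ Δ} → Prf G Γ (A ∷ B ∷ Δ) → Prf G Γ (B ∷ A ∷ Δ)
  swapR = exch ↭-refl swap-heads

  rotate₃ : ∀ {x y z : Fm} {xs} → x ∷ y ∷ z ∷ xs ↭ y ∷ z ∷ x ∷ xs
  rotate₃ {x} {y} {z} = ↭-trans (swap x y ↭-refl) (prep y (swap x z ↭-refl))

  ⊢⊤ : G ⊢ ⊤'
  ⊢⊤ = R∨₁ ⊥' (R¬ ax-⊥)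

  wL-++ : ∀ {Γ Δ} Ξ → Prf G Γ Δ → Prf G (Γ ++ Ξ) Δ
  wL-++ {Γ} [] π = exch (↭-reflexive (sym (++-identityʳ Γ))) ↭-refl π
  wL-++ {Γ} (x ∷ Ξ) π = exch (↭-sym (shift x Γ Ξ)) ↭-refl (wL x (wL-++ Ξ π))

  -- Both logics with (D) derive (K), which is what ruleD needs on the left side.
  ruleK-from-D : ∀ {Γ A} → HasD G → Prf G Γ (A ∷ []) → Prf G (□s Γ) (□ A ∷ [])
  ruleK-from-D KD-D π = ruleK KD-K π
  ruleK-from-D {Γ} KD4-D π = rule4 KD4-4 (wL-++ (□s Γ) π)

  ℳ-sound : ∀ {Γ₁ Γ₂ Δ₁ Δ₂} (π : Split Γ₁ Γ₂ Δ₁ Δ₂) → Prf G Γ₁ (ℳ π ∷ Δ₁) × Prf G (ℳ π ∷ Γ₂) Δ₂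
  ℳ-sound (ax-at-ll p) = wR ⊥' (ax-at p) , ax-⊥
  ℳ-sound (ax-at-rr p) = ⊢⊤ , wL ⊤' (ax-at p)
  ℳ-sound (ax-at-lr p) = ax-at p , ax-at p
  ℳ-sound (ax-at-rl p) = R¬ (ax-at p) , L¬ (ax-at p)
  ℳ-sound (ax-□-ll A) = wR ⊥' (ax-□ A) , ax-⊥
  ℳ-sound (ax-□-rr A) = ⊢⊤ , wL ⊤' (ax-□ A)
  ℳ-sound (ax-□-lr A) = ax-□ A , ax-□ A
  ℳ-sound (ax-□-rl A) = R¬ (ax-□ A) , L¬ (ax-□ A)
  ℳ-sound ax-⊥ˡ = wR ⊥' ax-⊥ , ax-⊥
  ℳ-sound ax-⊥ʳ = ⊢⊤ , wL ⊤' ax-⊥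
  ℳ-sound (exch a b c d π) with ℳ-sound π
  ... | l , r = exch a (prep _ c) l , exch (prep _ b) d r
  ℳ-sound (wLˡ A π) with ℳ-sound π
  ... | l , r = wL A l , r
  ℳ-sound (wLʳ A π) with ℳ-sound π
  ... | l , r = l , swapL (wL A r)
  ℳ-sound (wRˡ A π) with ℳ-sound π
  ... | l , r = swapR (wR A l) , r
  ℳ-sound (wRʳ A π) with ℳ-sound π
  ... | l , r = l , wR A r
  ℳ-sound (cLˡ π) with ℳ-sound π
  ... | l , r = cL l , r
  ℳ-sound (cLʳ π) with ℳ-sound π
  ... | l , r = l , swapL (cL (exch rotate₃ ↭-refl r))
  ℳ-sound (cRˡ π) with ℳ-sound π
  ... | l , r = swapR (cR (exch ↭-refl rotate₃ l)) , r
  ℳ-sound (cRʳ π) with ℳ-sound π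
  ... | l , r = l , cR r
  ℳ-sound (L∧₁ˡ B π) with ℳ-sound π
  ... | l , r = L∧₁ B l , r
  ℳ-sound (L∧₁ʳ B π) with ℳ-sound π
  ... | l , r = l , swapL (L∧₁ B (swapL r))
  ℳ-sound (L∧₂ˡ A π) with ℳ-sound π
  ... | l , r = L∧₂ A l , r
  ℳ-sound (L∧₂ʳ A π) with ℳ-sound π
  ... | l , r = l , swapL (L∧₂ A (swapL r))
  ℳ-sound (R∧ˡ π₁ π₂) with ℳ-sound π₁ | ℳ-sound π₂
  ... | l₁ , r₁ | l₂ , r₂ = swapR (R∧ (swapR (R∨₁ (ℳ π₂) l₁)) (swapR (R∨₂ (ℳ π₁) l₂))) , L∨ r₁ r₂
  ℳ-sound (R∧ʳ π₁ π₂) with ℳ-sound π₁ | ℳ-sound π₂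
  ... | l₁ , r₁ | l₂ , r₂ = R∧ l₁ l₂ , R∧ (L∧₁ (ℳ π₂) r₁) (L∧₂ (ℳ π₁) r₂)
  ℳ-sound (R∨₁ˡ B π) with ℳ-sound π
  ... | l , r = swapR (R∨₁ B (swapR l)) , r
  ℳ-sound (R∨₁ʳ B π) with ℳ-sound π
  ... | l , r = l , R∨₁ B r
  ℳ-sound (R∨₂ˡ A π) with ℳ-sound π
  ... | l , r = swapR (R∨₂ A (swapR l)) , r
  ℳ-sound (R∨₂ʳ A π) with ℳ-sound π
  ... | l , r = l , R∨₂ A r
  ℳ-sound (L∨ˡ π₁ π₂) with ℳ-sound π₁ | ℳ-sound π₂
  ... | l₁ , r₁ | l₂ , r₂ = L∨ (R∨₁ (ℳ π₂) l₁) (R∨₂ (ℳ π₁) l₂) , L∨ r₁ r₂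
  ℳ-sound (L∨ʳ π₁ π₂) with ℳ-sound π₁ | ℳ-sound π₂
  ... | l₁ , r₁ | l₂ , r₂ = R∧ l₁ l₂ , swapL (L∨ (swapL (L∧₁ (ℳ π₂) r₁)) (swapL (L∧₂ (ℳ π₁) r₂)))
  ℳ-sound (L¬ˡ π) with ℳ-sound π
  ... | l , r = L¬ (swapR l) , r
  ℳ-sound (L¬ʳ π) with ℳ-sound π
  ... | l , r = l , swapL (L¬ r)
  ℳ-sound (R¬ˡ π) with ℳ-sound π
  ... | l , r = swapR (R¬ l) , r
  ℳ-sound (R¬ʳ π) with ℳ-sound π
  ... | l , r = l , R¬ (swapL r)
  ℳ-sound (cutˡ A _ _ π₁ π₂) with ℳ-sound π₁ | ℳ-sound π₂
  ... | l₁ , r₁ | l₂ , r₂ = cut A (swapR (R∨₁ (ℳ π₂) l₁)) (R∨₂ (ℳ π₁) l₂) , L∨ r₁ r₂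
  ℳ-sound (cutʳ A _ _ π₁ π₂) with ℳ-sound π₁ | ℳ-sound π₂
  ... | l₁ , r₁ | l₂ , r₂ = R∧ l₁ l₂ , cut A (L∧₁ (ℳ π₂) r₁) (swapL (L∧₂ (ℳ π₁) r₂))
  ℳ-sound (ruleKˡ h π) with ℳ-sound π
  ... | l , r = R¬ (ruleK h (L¬ l)) , L¬ (ruleK h (R¬ r))
  ℳ-sound (ruleKʳ h π) with ℳ-sound π
  ... | l , r = ruleK h l , ruleK h r
  ℳ-sound (ruleD h π) with ℳ-sound π
  ... | l , r = ruleK-from-D h l , ruleD h r
  ℳ-sound (rule4ˡ {Γ₁} h π) with ℳ-sound π
  ... | l , r = R¬ (rule4 h (exch ¬C-to-front ↭-refl (wL (□ (¬' (ℳ π))) (L¬ l)))) , L¬ (rule4 h (R¬ r))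
    where
    ¬C-to-front : □ (¬' (ℳ π)) ∷ ¬' (ℳ π) ∷ Γ₁ ++ □s Γ₁ ↭ ¬' (ℳ π) ∷ Γ₁ ++ □ (¬' (ℳ π)) ∷ □s Γ₁
    ¬C-to-front = ↭-trans swap-heads (prep (¬' (ℳ π)) (↭-sym (shift (□ (¬' (ℳ π))) Γ₁ (□s Γ₁))))
  ℳ-sound (rule4ʳ {Γ₂ = Γ₂} h π) with ℳ-sound π
  ... | l , r = rule4 h l , rule4 h (exch C-to-front ↭-refl (wL (□ (ℳ π)) r))
    where
    C-to-front : □ (ℳ π) ∷ ℳ π ∷ Γ₂ ++ □s Γ₂ ↭ ℳ π ∷ Γ₂ ++ □ (ℳ π) ∷ □s Γ₂
    C-to-front = ↭-trans swap-heads (prep (ℳ π) (↭-sym (shift (□ (ℳ π)) Γ₂ (□s Γ₂))))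
  ℳ-sound (ruleTˡ h π) with ℳ-sound π
  ... | l , r = ruleT h l , r
  ℳ-sound (ruleTʳ h π) with ℳ-sound π
  ... | l , r = l , swapL (ruleT h (swapL r))

  _≈_ : Fm → Fm → Set
  X ≈ Y = Prf G (X ∷ []) (Y ∷ []) × Prf G (Y ∷ []) (X ∷ [])

  identity : ∀ A → Prf G (A ∷ []) (A ∷ [])
  identity (at p) = ax-at p
  identity ⊥' = wR ⊥' ax-⊥
  identity (A ∧' B) = R∧ (L∧₁ B (identity A)) (L∧₂ A (identity B))
  identity (A ∨' B) = L∨ (R∨₁ B (identity A)) (R∨₂ A (identity B))
  identity (¬' A) = R¬ (swapL (L¬ (identity A)))
  identity (□ A) = ax-□ A

  ≈-refl : ∀ X → X ≈ X
  ≈-refl X = identity X , identity X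

  ≈-sym : ∀ {X Y} → X ≈ Y → Y ≈ X
  ≈-sym (a , b) = b , a

  sequent-trans : ∀ {X Y Z} → Prf G (X ∷ []) (Y ∷ []) → Prf G (Y ∷ []) (Z ∷ []) → Prf G (X ∷ []) (Z ∷ [])
  sequent-trans {X} {Y} {Z} a b = cut Y (swapR (wR Z a)) (swapL (wL X b))

  ≈-trans : ∀ {X Y Z} → X ≈ Y → Y ≈ Z → X ≈ Z
  ≈-trans (a , b) (c , d) = sequent-trans a c , sequent-trans d b

  ∧-cong : ∀ {X X' Y Y'} → X ≈ X' → Y ≈ Y' → (X ∧' Y) ≈ (X' ∧' Y')
  ∧-cong {X} {X'} {Y} {Y'} (a , b) (c , d) = R∧ (L∧₁ Y a) (L∧₂ X c) , R∧ (L∧₁ Y' b) (L∧₂ X' d)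

  ∨-cong : ∀ {X X' Y Y'} → X ≈ X' → Y ≈ Y' → (X ∨' Y) ≈ (X' ∨' Y')
  ∨-cong {X} {X'} {Y} {Y'} (a , b) (c , d) = L∨ (R∨₁ Y' a) (R∨₂ X' c) , L∨ (R∨₁ Y b) (R∨₂ X d)

  ⊤≈¬⊥ : ⊤' ≈ ¬' ⊥'
  ⊤≈¬⊥ = L∨ (identity (¬' ⊥')) (wR (¬' ⊥') ax-⊥) , R∨₁ ⊥' (identity (¬' ⊥'))

  ⊃-intro : ∀ {X Y} → Prf G (X ∷ []) (Y ∷ []) → G ⊢ (X ⊃ Y)
  ⊃-intro {X} {Y} p = cR (R∨₁ Y (swapR (R∨₂ (¬' X) (swapR (R¬ p)))))

  ≈⇒⊢⇔ : ∀ {X Y} → X ≈ Y → G ⊢ (X ⇔ Y)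
  ≈⇒⊢⇔ (a , b) = R∧ (⊃-intro a) (⊃-intro b)

  map-++-++ : ∀ {A : Set} (f : A → Fm) xs ys Δ → map f xs ++ map f ys ++ Δ ≡ map f (xs ++ ys) ++ Δ
  map-++-++ f xs ys Δ = trans (sym (++-assoc (map f xs) (map f ys) Δ)) (cong (_++ Δ) (sym (map-++ f xs ys)))

  succedent-lits-++ : ∀ {Γ} c d Δ → RPrf Γ (lits d ++ lits c ++ Δ) → RPrf Γ (lits (c ++ d) ++ Δ)
  succedent-lits-++ c d Δ = exR (↭-trans (shifts (lits d) (lits c)) (↭-reflexive (map-++-++ ⟦_⟧ℓ c d Δ)))

  antecedent-clauses-++ : ∀ {Δ} cs ds Γ → RPrf (clauses ds ++ clauses cs ++ Γ) Δ →
                          RPrf (clauses (cs ++ ds) ++ Γ) Δ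
  antecedent-clauses-++ cs ds Γ =
    exL (↭-trans (shifts (clauses ds) (clauses cs)) (↭-reflexive (map-++-++ ⟦_⟧c cs ds Γ)))

  cnf⁺-succedent : ∀ C {Γ Δ} → RPrf Γ (C ∷ Δ) → All (λ c → RPrf Γ (lits c ++ Δ)) (cnf⁺ C)
  cnf⁻-succedent : ∀ C {Γ Δ} → RPrf (C ∷ Γ) Δ → All (λ c → RPrf Γ (lits c ++ Δ)) (cnf⁻ C)
  cnf⁺-succedent (at p) π = π ∷ []
  cnf⁺-succedent ⊥' π = π ∷ []
  cnf⁺-succedent (□ A) π = π ∷ []
  cnf⁺-succedent (X ∧' Y) π = ++⁺ (cnf⁺-succedent X (R∧-inv₁ X Y π)) (cnf⁺-succedent Y (R∧-inv₂ X Y π))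
  cnf⁺-succedent (X ∨' Y) {Γ} {Δ} π = All-⊗ (cnf⁺ X) (cnf⁺ Y)
    (All.map (λ {c} πc → All.map (λ {d} → succedent-lits-++ c d Δ)
                                 (cnf⁺-succedent Y (exR (shift Y (lits c) Δ) πc)))
             (cnf⁺-succedent X (R∨-inv X Y π)))
  cnf⁺-succedent (¬' X) π = cnf⁻-succedent X (R¬-inv X π)
  cnf⁻-succedent (at p) π = R¬ π ∷ []
  cnf⁻-succedent ⊥' π = R¬ π ∷ []
  cnf⁻-succedent (□ A) π = R¬ π ∷ []
  cnf⁻-succedent (X ∨' Y) π = ++⁺ (cnf⁻-succedent X (L∨-inv₁ X Y π)) (cnf⁻-succedent Y (L∨-inv₂ X Y π))
  cnf⁻-succedent (X ∧' Y) {Γ} {Δ} π = All-⊗ (cnf⁻ X) (cnf⁻ Y)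
    (All.map (λ {c} πc → All.map (λ {d} → succedent-lits-++ c d Δ) (cnf⁻-succedent Y πc))
             (cnf⁻-succedent X (L∧-inv X Y π)))
  cnf⁻-succedent (¬' X) π = cnf⁺-succedent X (L¬-inv X π)

  ex-falso : ∀ Γ Δ → RPrf (⊥' ∷ Γ) Δ
  ex-falso [] [] = ax-⊥
  ex-falso [] (A ∷ Δ) = wR A (ex-falso [] Δ)
  ex-falso (A ∷ Γ) Δ = exL swap-heads (wL A (ex-falso Γ Δ))

  L∨-clause-++ : ∀ c d {Π Δ} → RPrf (⟦ c ⟧c ∷ Π) Δ → RPrf (⟦ d ⟧c ∷ Π) Δ → RPrf (⟦ c ++ d ⟧c ∷ Π) Δ
  L∨-clause-++ [] d _ π = π
  L∨-clause-++ (ℓ ∷ c) d π₁ π₂ = L∨ (L∨-inv₁ _ _ π₁) (L∨-clause-++ c d (L∨-inv₂ _ _ π₁) π₂)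

  antecedent-clauses-map-++ : ∀ c ds {Π Δ} → RPrf (⟦ c ⟧c ∷ Π) Δ → RPrf (clauses ds ++ Π) Δ →
                              RPrf (clauses (map (c ++_) ds) ++ Π) Δ
  antecedent-clauses-map-++ c [] _ π = π
  antecedent-clauses-map-++ c (d ∷ ds) {Π} π₁ π₂ =
    L∨-clause-++ c d (exL (shift ⟦ c ⟧c rest Π) (wL* rest π₁))
      (exL (shift ⟦ d ⟧c rest Π)
           (antecedent-clauses-map-++ c ds (exL swap-heads (wL ⟦ d ⟧c π₁))
                                      (exL (↭-sym (shift ⟦ d ⟧c (clauses ds) Π)) π₂)))
    where
    rest = clauses (map (c ++_) ds)

  antecedent-clauses-⊗ : ∀ cs ds {Γ Δ} → RPrf (clauses cs ++ Γ) Δ → RPrf (clauses ds ++ Γ) Δ →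
                         RPrf (clauses (cs ⊗ ds) ++ Γ) Δ
  antecedent-clauses-⊗ [] ds π₁ π₂ = π₁
  antecedent-clauses-⊗ (c ∷ cs) ds {Γ} π₁ π₂ =
    exL (↭-reflexive (map-++-++ ⟦_⟧c (map (c ++_) ds) (cs ⊗ ds) Γ))
      (antecedent-clauses-map-++ c ds (exL (shift ⟦ c ⟧c rest Γ) with-c)
                                      (exL (shifts rest (clauses ds)) (wL* rest π₂)))
    where
    rest = clauses (cs ⊗ ds)
    with-c = antecedent-clauses-⊗ cs ds {⟦ c ⟧c ∷ Γ} (exL (↭-sym (shift ⟦ c ⟧c (clauses cs) Γ)) π₁)
                                                    (exL (↭-sym (shift ⟦ c ⟧c (clauses ds) Γ)) (wL ⟦ c ⟧c π₂))

  cnf⁺-antecedent : ∀ C {Γ Δ} → RPrf (C ∷ Γ) Δ → RPrf (clauses (cnf⁺ C) ++ Γ) Δ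
  cnf⁻-antecedent : ∀ C {Γ Δ} → RPrf Γ (C ∷ Δ) → RPrf (clauses (cnf⁻ C) ++ Γ) Δ
  cnf⁺-antecedent (at p) {Γ} {Δ} π = L∨ π (ex-falso Γ Δ)
  cnf⁺-antecedent ⊥' {Γ} {Δ} π = L∨ π (ex-falso Γ Δ)
  cnf⁺-antecedent (□ A) {Γ} {Δ} π = L∨ π (ex-falso Γ Δ)
  cnf⁺-antecedent (X ∧' Y) {Γ} π = antecedent-clauses-++ (cnf⁺ X) (cnf⁺ Y) Γ
    (cnf⁺-antecedent Y (exL (shift Y (clauses (cnf⁺ X)) Γ) (cnf⁺-antecedent X (L∧-inv X Y π))))
  cnf⁺-antecedent (X ∨' Y) π =
    antecedent-clauses-⊗ (cnf⁺ X) (cnf⁺ Y) (cnf⁺-antecedent X (L∨-inv₁ X Y π))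
                                           (cnf⁺-antecedent Y (L∨-inv₂ X Y π))
  cnf⁺-antecedent (¬' X) π = cnf⁻-antecedent X (L¬-inv X π)
  cnf⁻-antecedent (at p) {Γ} {Δ} π = L∨ (L¬ π) (ex-falso Γ Δ)
  cnf⁻-antecedent ⊥' {Γ} {Δ} π = L∨ (L¬ π) (ex-falso Γ Δ)
  cnf⁻-antecedent (□ A) {Γ} {Δ} π = L∨ (L¬ π) (ex-falso Γ Δ)
  cnf⁻-antecedent (X ∧' Y) π =
    antecedent-clauses-⊗ (cnf⁻ X) (cnf⁻ Y) (cnf⁻-antecedent X (R∧-inv₁ X Y π))
                                           (cnf⁻-antecedent Y (R∧-inv₂ X Y π))
  cnf⁻-antecedent (X ∨' Y) {Γ} π =
    antecedent-clauses-++ (cnf⁻ X) (cnf⁻ Y) Γ (cnf⁻-antecedent Y (cnf⁻-antecedent X (R∨-inv X Y π)))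
  cnf⁻-antecedent (¬' X) π = cnf⁺-antecedent X (R¬-inv X π)

  clause-cases : ∀ D {Π Δ} → RPrf (⟦ D ⟧c ∷ Π) Δ → All (λ ℓ → RPrf (⟦ ℓ ⟧ℓ ∷ Π) Δ) D
  clause-cases [] π = []
  clause-cases (ℓ ∷ D) π = L∨-inv₁ _ _ π ∷ clause-cases D (L∨-inv₂ _ _ π)

  ≈⊤-intro : ∀ {X} → G ⊢ X → X ≈ ⊤'
  ≈⊤-intro {X} ⊢X = wL X ⊢⊤ , wL ⊤' ⊢X

  ≈⊥-intro : ∀ {X} → Prf G (X ∷ []) [] → X ≈ ⊥'
  ≈⊥-intro {X} X⇒ = wR ⊥' X⇒ , wR X ax-⊥

  weaken-prefix : ∀ {Γ₁ Γ₂ Δ₁ Δ₂} Ξ₁ Ξ₂ Θ₁ Θ₂ → Split Γ₁ Γ₂ Δ₁ Δ₂ →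
                  Split (Ξ₁ ++ Γ₁) (Ξ₂ ++ Γ₂) (Θ₁ ++ Δ₁) (Θ₂ ++ Δ₂)
  weaken-prefix (x ∷ Ξ₁) Ξ₂ Θ₁ Θ₂ π = wLˡ x (weaken-prefix Ξ₁ Ξ₂ Θ₁ Θ₂ π)
  weaken-prefix [] (x ∷ Ξ₂) Θ₁ Θ₂ π = wLʳ x (weaken-prefix [] Ξ₂ Θ₁ Θ₂ π)
  weaken-prefix [] [] (x ∷ Θ₁) Θ₂ π = wRˡ x (weaken-prefix [] [] Θ₁ Θ₂ π)
  weaken-prefix [] [] [] (x ∷ Θ₂) π = wRʳ x (weaken-prefix [] [] [] Θ₂ π)
  weaken-prefix [] [] [] [] π = π

  ℳ-weaken-prefix : ∀ {Γ₁ Γ₂ Δ₁ Δ₂} Ξ₁ Ξ₂ Θ₁ Θ₂ (π : Split Γ₁ Γ₂ Δ₁ Δ₂) →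
                    ℳ (weaken-prefix Ξ₁ Ξ₂ Θ₁ Θ₂ π) ≡ ℳ π
  ℳ-weaken-prefix (x ∷ Ξ₁) Ξ₂ Θ₁ Θ₂ π = ℳ-weaken-prefix Ξ₁ Ξ₂ Θ₁ Θ₂ π
  ℳ-weaken-prefix [] (x ∷ Ξ₂) Θ₁ Θ₂ π = ℳ-weaken-prefix [] Ξ₂ Θ₁ Θ₂ π
  ℳ-weaken-prefix [] [] (x ∷ Θ₁) Θ₂ π = ℳ-weaken-prefix [] [] Θ₁ Θ₂ π
  ℳ-weaken-prefix [] [] [] (x ∷ Θ₂) π = ℳ-weaken-prefix [] [] [] Θ₂ π
  ℳ-weaken-prefix [] [] [] [] π = refl

  weaken : ∀ {Γ₁ Γ₂ Δ₁ Δ₂ X} Ξ₁ Ξ₂ Θ₁ Θ₂ (π : Split Γ₁ Γ₂ Δ₁ Δ₂) → ℳ π ≈ X →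
           Σ (Split (Γ₁ ++ Ξ₁) (Γ₂ ++ Ξ₂) (Δ₁ ++ Θ₁) (Δ₂ ++ Θ₂)) λ π' → ℳ π' ≈ X
  weaken {Γ₁} {Γ₂} {Δ₁} {Δ₂} {X} Ξ₁ Ξ₂ Θ₁ Θ₂ π e =
    exch (++-comm Ξ₁ Γ₁) (++-comm Ξ₂ Γ₂) (++-comm Θ₁ Δ₁) (++-comm Θ₂ Δ₂) (weaken-prefix Ξ₁ Ξ₂ Θ₁ Θ₂ π) ,
    subst (_≈ X) (sym (ℳ-weaken-prefix Ξ₁ Ξ₂ Θ₁ Θ₂ π)) e

  left-only : ∀ {Γ₁ Δ₁} Γ₂ Δ₂ → RPrf Γ₁ Δ₁ → Σ (Split Γ₁ Γ₂ Δ₁ Δ₂) λ π → ℳ π ≈ ⊥'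
  left-only {Γ₁} {Δ₁} Γ₂ Δ₂ π = exch (++-[] Γ₁) ↭-refl (++-[] Δ₁) ↭-refl (proj₁ w) , proj₂ w
    where
    λ₀ = all-left π
    w = weaken [] Γ₂ [] Δ₂ λ₀ (≈⊥-intro (proj₂ (ℳ-sound λ₀)))

  right-only : ∀ {Γ₂ Δ₂} Γ₁ Δ₁ → RPrf Γ₂ Δ₂ → Σ (Split Γ₁ Γ₂ Δ₁ Δ₂) λ π → ℳ π ≈ ⊤'
  right-only {Γ₂} {Δ₂} Γ₁ Δ₁ π = exch ↭-refl (++-[] Γ₂) ↭-refl (++-[] Δ₂) (proj₁ w) , proj₂ w
    where
    ρ₀ = swap-sides (all-left π)
    w = weaken Γ₁ [] Δ₁ [] ρ₀ (≈⊤-intro (proj₁ (ℳ-sound ρ₀)))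

  split-identityˡʳ : ∀ {a} → Elementary a → ∀ Γ₁ Γ₂ Δ₁ Δ₂ → Σ (Split (a ∷ Γ₁) Γ₂ Δ₁ (a ∷ Δ₂)) λ ι → ℳ ι ≈ a
  split-identityˡʳ (atom p) Γ₁ Γ₂ Δ₁ Δ₂ = weaken Γ₁ Γ₂ Δ₁ Δ₂ (ax-at-lr p) (≈-refl (at p))
  split-identityˡʳ bot Γ₁ Γ₂ Δ₁ Δ₂ = weaken Γ₁ Γ₂ Δ₁ Δ₂ (wRʳ ⊥' ax-⊥ˡ) (≈-refl ⊥')
  split-identityˡʳ (box A) Γ₁ Γ₂ Δ₁ Δ₂ = weaken Γ₁ Γ₂ Δ₁ Δ₂ (ax-□-lr A) (≈-refl (□ A))

  split-identityʳˡ : ∀ {a} → Elementary a → ∀ Γ₁ Γ₂ Δ₁ Δ₂ → Σ (Split Γ₁ (a ∷ Γ₂) (a ∷ Δ₁) Δ₂) λ ι → ℳ ι ≈ ¬' a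
  split-identityʳˡ (atom p) Γ₁ Γ₂ Δ₁ Δ₂ = weaken Γ₁ Γ₂ Δ₁ Δ₂ (ax-at-rl p) (≈-refl (¬' (at p)))
  split-identityʳˡ bot Γ₁ Γ₂ Δ₁ Δ₂ = weaken Γ₁ Γ₂ Δ₁ Δ₂ (wRˡ ⊥' ax-⊥ʳ) ⊤≈¬⊥
  split-identityʳˡ (box A) Γ₁ Γ₂ Δ₁ Δ₂ = weaken Γ₁ Γ₂ Δ₁ Δ₂ (ax-□-rl A) (≈-refl (¬' (□ A)))

  Branch : Fm → Lit → List Fm → List Fm → List Fm → List Fm → Set
  Branch E (pos a) Γ₁ Γ₂ Δ₁ Δ₂ = Σ (Split Γ₁ (a ∷ Γ₂) Δ₁ Δ₂) λ ρ → ℳ ρ ≈ E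
  Branch E (neg a) Γ₁ Γ₂ Δ₁ Δ₂ = Σ (Split Γ₁ Γ₂ Δ₁ (a ∷ Δ₂)) λ ρ → ℳ ρ ≈ E

  Branch-wRˡ : ∀ {E Γ₁ Γ₂ Δ₁ Δ₂} x ℓ → Branch E ℓ Γ₁ Γ₂ Δ₁ Δ₂ → Branch E ℓ Γ₁ Γ₂ (x ∷ Δ₁) Δ₂
  Branch-wRˡ x (pos a) (ρ , e) = wRˡ x ρ , e
  Branch-wRˡ x (neg a) (ρ , e) = wRˡ x ρ , e

  Branch-wLˡ : ∀ {E Γ₁ Γ₂ Δ₁ Δ₂} x ℓ → Branch E ℓ Γ₁ Γ₂ Δ₁ Δ₂ → Branch E ℓ (x ∷ Γ₁) Γ₂ Δ₁ Δ₂
  Branch-wLˡ x (pos a) (ρ , e) = wLˡ x ρ , e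
  Branch-wLˡ x (neg a) (ρ , e) = wLˡ x ρ , e

  -- Each literal a is cut in on the left side; the premise with a on the left is closed by a cut
  -- on a on the right side between the split identity for a and the branch for a.
  split-clause : ∀ S E D {Γ₁ Γ₂ Δ₁ Δ₂} → All (ElementaryOver S) D → S ⊆ Vs (Γ₁ ++ Δ₁) → S ⊆ Vs (Γ₂ ++ Δ₂) →
                 RPrf Γ₁ (lits D ++ Δ₁) → All (λ ℓ → Branch E ℓ Γ₁ Γ₂ Δ₁ Δ₂) D →
                 Σ (Split Γ₁ Γ₂ Δ₁ Δ₂) λ π → ℳ π ≈ clause-interpolant D E
  split-clause S E [] {Γ₂ = Γ₂} {Δ₂ = Δ₂} [] _ _ π [] = left-only Γ₂ Δ₂ π
  split-clause S E (pos a ∷ D) {Γ₁} {Γ₂} {Δ₁} {Δ₂} ((ea , Va) ∷ eD) S₁ S₂ π ((ρ , eρ) ∷ ρs)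
    with split-clause S E D eD (λ m → Vs-insert a Γ₁ Δ₁ (S₁ m)) S₂ (exR (↭-sym (shift a (lits D) Δ₁)) π)
                      (All.map (λ {ℓ} → Branch-wRˡ a ℓ) ρs)
       | split-identityˡʳ ea Γ₁ Γ₂ Δ₁ Δ₂
  ... | κ , eκ | ι , eι =
    cutˡ a (Elementary⇒AtomicOrBoxed ea) (λ m → S₁ (Va m)) κ
         (cutʳ a (Elementary⇒AtomicOrBoxed ea) (λ m → S₂ (Va m)) ι (wLˡ a ρ)) ,
    ∨-cong eκ (∧-cong eι eρ)
  split-clause S E (neg a ∷ D) {Γ₁} {Γ₂} {Δ₁} {Δ₂} ((ea , Va) ∷ eD) S₁ S₂ π ((ρ , eρ) ∷ ρs)
    with split-clause S E D eD (λ m → Vs-∷ a Γ₁ Δ₁ (S₁ m)) S₂ (R¬-inv a π)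
                      (All.map (λ {ℓ} → Branch-wLˡ a ℓ) ρs)
       | split-identityʳˡ ea Γ₁ Γ₂ Δ₁ Δ₂
  ... | κ , eκ | ι , eι =
    cutˡ a (Elementary⇒AtomicOrBoxed ea) (λ m → S₁ (Va m))
         (cutʳ a (Elementary⇒AtomicOrBoxed ea) (λ m → S₂ (Va m)) (wRˡ a ρ) ι) κ ,
    ∨-cong (∧-cong eρ eι) eκ

  split-cnf : ∀ S Ds {Γ₁ Γ₂ Δ₁ Δ₂} → All (All (ElementaryOver S)) Ds → S ⊆ Vs (Γ₁ ++ Δ₁) → S ⊆ Vs (Γ₂ ++ Δ₂) →
              All (λ D → RPrf Γ₁ (lits D ++ Δ₁)) Ds → RPrf (clauses Ds ++ Γ₂) Δ₂ →
              Σ (Split Γ₁ Γ₂ Δ₁ Δ₂) λ π → ℳ π ≈ cnf-interpolant Ds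
  split-cnf S [] {Γ₁} {Δ₁ = Δ₁} [] _ _ [] π = right-only Γ₁ Δ₁ π
  split-cnf S (D ∷ Ds) {Γ₁} {Γ₂} {Δ₁} {Δ₂} (eD ∷ eDs) S₁ S₂ (πD ∷ πDs) π =
    split-clause S (cnf-interpolant Ds) D eD S₁ S₂ πD (branches D (clause-cases D π))
    where
    branches : ∀ D' → All (λ ℓ → RPrf (⟦ ℓ ⟧ℓ ∷ clauses Ds ++ Γ₂) Δ₂) D' →
               All (λ ℓ → Branch (cnf-interpolant Ds) ℓ Γ₁ Γ₂ Δ₁ Δ₂) D'
    branches [] [] = []
    branches (pos a ∷ D') (πa ∷ πs) =
      split-cnf S Ds eDs S₁ (λ m → Vs-∷ a Γ₂ Δ₂ (S₂ m)) πDs (exL (↭-sym (shift a (clauses Ds) Γ₂)) πa)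
      ∷ branches D' πs
    branches (neg a ∷ D') (πa ∷ πs) =
      split-cnf S Ds eDs S₁ (λ m → Vs-insert a Γ₂ Δ₂ (S₂ m)) πDs (L¬-inv a πa) ∷ branches D' πs

  split-with-cnf-interpolant : ∀ {X Y} C → V C ⊆ V X → V C ⊆ V Y →
                               RPrf (X ∷ []) (C ∷ []) → RPrf (C ∷ []) (Y ∷ []) →
                               Σ (Split (X ∷ []) [] [] (Y ∷ [])) λ π → ℳ π ≈ cnf-interpolant (cnf⁺ C)
  split-with-cnf-interpolant C VX VY X⇒C C⇒Y =
    split-cnf (V C) (cnf⁺ C) (cnf⁺-elementary C (λ m → m)) (λ m → ∈-++⁺ˡ (VX m)) (λ m → ∈-++⁺ˡ (VY m))
              (cnf⁺-succedent C X⇒C) (cnf⁺-antecedent C C⇒Y)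

  cnf-interpolant-cnf⁺ : ∀ C → cnf-interpolant (cnf⁺ C) ≈ C
  cnf-interpolant-cnf⁺ C with split-with-cnf-interpolant C (λ m → m) (λ m → m) C⇒C C⇒C
    where C⇒C = restrict-cuts (identity C)
  ... | π , e with ℳ-sound π
  ... | C⇒ℳ , ℳ⇒C = ≈-trans (≈-sym e) (ℳ⇒C , C⇒ℳ)

  interpolation-complete : ∀ A B C → V C ⊆ V A → V C ⊆ V B → G ⊢ (A ⊃ C) → G ⊢ (C ⊃ B) →
                           Σ (Split (A ∷ []) [] [] (B ∷ [])) λ π → G ⊢ (ℳ π ⇔ C)
  interpolation-complete A B C VA VB ⊢A⊃C ⊢C⊃B
    with split-with-cnf-interpolant C VA VB (implication⇒sequent ⊢A⊃C) (implication⇒sequent ⊢C⊃B)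
  ... | π , e = π , ≈⇒⊢⇔ (≈-trans e (cnf-interpolant-cnf⁺ C))

theorem7p2 : (G : Logic) (A B C : Fm) →
    G ⊢ (A ⊃ B) →
    V C ⊆ V A → V C ⊆ V B →
    G ⊢ (A ⊃ C) → G ⊢ (C ⊃ B) →
    Σ (SPrf G AtomicOrBoxed (A ∷ []) [] [] (B ∷ []))
      (λ π → G ⊢ (M G AtomicOrBoxed π ⇔ C))
theorem7p2 G A B C _ = interpolation-complete G A B C
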